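{- Standard reduction is terminating on valid types, terms and substitutions: there is no infinite sequence $x_0\rightsquigarrow x_1\rightsquigarrow x_2\rightsquigarrow\cdots$ of standard reductions starting from a type, term or substitution $x_0$ that is valid in some context.
   Context: The type theory $\mathrm{Catt}_{\mathrm{su}}$. Fix an infinite set $V$ of variables containing distinct variables $d_i,d_i'$ ($i\in\mathbb N$). Raw syntax: contexts $\Gamma::=\emptyset\mid \Gamma,x:A$; types $A::=\star\mid s\to_A t$; terms $t::=x\mid \mathsf{coh}(\Gamma:A)[\sigma]$; substitutions $\sigma::=\langle\rangle\mid\langle\sigma,x\mapsto t\rangle$ (lists of terms, written $[t_1,\dots,t_n]$). $\equiv$ is syntactic equality up to $\alpha$-equivalence. $\mathrm{FV}$ denotes free variables, $\mathrm{FV}(\mathsf{coh}(\Gamma:A)[\sigma])=\mathrm{FV}(\sigma)$; $\mathrm{FV}(\Gamma)$ is the set of variables of $\Gamma$. Substitution application: $\star[\sigma]=\star$, $(s\to_A t)[\sigma]=s[\sigma]\to_{A[\sigma]}t[\sigma]$, $x[\sigma]$ the entry of $\sigma$ for $x$, $\mathsf{coh}(\Gamma:A)[\tau][\sigma]=\mathsf{coh}(\Gamma:A)[\tau\circ\sigma]$, where $\langle\rangle\circ\sigma=\langle\rangle$, $\langle\tau,x\mapsto t\rangle\circ\sigma=\langle\tau\circ\sigma,x\mapsto t[\sigma]\rangle$; $\mathrm{id}_\Gamma$ sends each variable to itself. $\dim\star=-1$, $\dim(s\to_A t)=\dim A+1$; a variable $x:A$ has dimension $\dim A+1$; $\dim\emptyset=-1$,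 $\dim(\Gamma,x:A)=\max(\dim\Gamma,\dim A+1)$. Typing judgements $\Gamma\vdash$, $\Gamma\vdash A$, $\Gamma\vdash t:A$, $\Gamma\vdash\sigma:\Delta$: $\emptyset\vdash$; $\Gamma\vdash A\Rightarrow\Gamma,x:A\vdash$; $\Gamma\vdash\Rightarrow\Gamma\vdash\star$; $\Gamma\vdash A,\Gamma\vdash s:A,\Gamma\vdash t:A\Rightarrow\Gamma\vdash s\to_A t$; $\Gamma\vdash\Rightarrow\Gamma\vdash\langle\rangle:\emptyset$; $\Gamma\vdash\sigma:\Delta,\Delta\vdash A,\Gamma\vdash t:A[\sigma]\Rightarrow\Gamma\vdash\langle\sigma,x\mapsto t\rangle:(\Delta,x:A)$; $(x:A)\in\Gamma\vdash$ gives $\Gamma\vdash x:A$; the coherence rule below; conversion: $\Gamma\vdash t:A,\Gamma\vdash A=B\Rightarrow\Gamma\vdash t:B$. Something is valid in $\Gamma$ if it is typable in $\Gamma$ by these rules. Pasting contexts: $\Gamma\vdash_p x:A$ generated by $(x:\star)\vdash_p x:\star$; from $\Gamma\vdash_p x:A$ infer $\Gamma,y:A,f:x\to_A y\vdash_p f:x\to_A y$ (introduction step); from $\Gamma\vdash_p f:x\to_A y$ infer $\Gamma\vdash_p y:A$ (descent step); $\Gamma\vdash_p$ if $\Gamma\vdash_p x:\star$ for some $x$. $\partial^\mp(\Gamma)$: variables of dimension $<\dim\Gamma-1$ plus those of dimension $\dim\Gamma-1$ not occurring as target (resp. source) in the type of another variable. $\mathrm{supp}(t)$: closure of $\mathrm{FV}(t)$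 under adding $\mathrm{FV}(A)$ for each contained $x$ with $(x:A)\in\Gamma$. Coherence rule: if $\Gamma\vdash_p$, $\Gamma\vdash s\to_A t$, $\Delta\vdash\sigma:\Gamma$, and either ($\mathrm{supp}(s)=\partial^-(\Gamma)$, $\mathrm{supp}(t)=\partial^+(\Gamma)$) or $\mathrm{supp}(s)=\mathrm{supp}(t)=\mathrm{FV}(\Gamma)$, then $\Delta\vdash\mathsf{coh}(\Gamma:s\to_A t)[\sigma]:s[\sigma]\to_{A[\sigma]}t[\sigma]$. Discs: $D^0=(d_0:\star)$, $S^{ -1}=\star$, $D^{k+1}=D^k,(d_k':S^{k-1}),(d_{k+1}:S^k)$, $S^k=d_k\to_{S^{k-1}}d_k'$; $\mathsf{i}_k:=\mathsf{coh}(D^k:d_k\to_{S^{k-1}}d_k)[\mathrm{id}_{D^k}]$; a term is an identity if it is syntactically $\mathsf{i}_k[\tau]$. $\{\star,t\}=\langle t\rangle$, $\{u\to_A v,t\}=\langle\{A,u\},v,t\rangle$. Pruning: a locally maximal variable of a pasting context $\Delta$ is one introduced by an introduction step immediately followed by a descent step. For locally maximal $\alpha:s\to_A t$: $\Delta/\!\!/\alpha$ deletes $t,\alpha$ from $\Delta$; $\pi_\alpha$ sends $\alpha\mapsto\mathsf{i}_{\dim A+1}[\{A,s\}]$, $t\mapsto s$, others to themselves; $\sigma/\!\!/\alpha$ removes the entries for $t,\alpha$ from $\sigma$. Definitional equality $\Gamma\vdash s=t$: smallest relation containing $x=x$ for variables of $\Gamma$, closed under symmetry, transitivity, congruence for $\mathsf{coh}$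 (equal types and equal substitutions give equal coherences), and generated by (prune) $\mathsf{coh}(\Delta:A)[\sigma]=\mathsf{coh}(\Delta/\!\!/\alpha:A[\pi_\alpha])[\sigma/\!\!/\alpha]$ when the left side is well typed, $\alpha$ locally maximal, $\alpha[\sigma]$ an identity; (disc) $\mathsf{coh}(D^{n+1}:S^n)[\sigma]=d_{n+1}[\sigma]$ when well typed; (endo) $\mathsf{coh}(\Delta:t\to_A t)[\sigma]=\mathsf{i}_{\dim A+1}[\{A,t\}\circ\sigma]$ when well typed. Equality on types and substitutions is induced componentwise. Standard reduction $\rightsquigarrow$ on types, terms and substitutions (mutual induction): a type $u\to_T v$ reduces by the first applicable of: reduce $T$; else reduce $u$; else reduce $v$; $\star$ does not reduce. A substitution reduces its leftmost reducible entry. Variables do not reduce; $t\equiv\mathsf{coh}(\Gamma:U)[\sigma]$ reduces by the first applicable of: (A) $\sigma\rightsquigarrow\tilde\sigma$ gives $\mathsf{coh}(\Gamma:U)[\tilde\sigma]$; (B) if $t$ is not an identity and $x$ is the leftmost locally maximal variable with $x[\sigma]$ an identity, gives $\mathsf{coh}(\Gamma/\!\!/x:U[\pi_x])[\sigma/\!\!/x]$; (C) $U\rightsquigarrow\tilde U$ gives $\mathsf{coh}(\Gamma:\tilde U)[\sigma]$; (D) if $\Gamma\equiv D^{n+1}$, $U\equiv S^n$, gives the last entry of $\sigma$; (E) if $t$ is not an identity and $U\equiv u\to_T u$, gives $\mathsf{i}_{\dim T+1}[\{T,u\}\circ\sigma]$. -}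

module Defs where

-- Catt_su, formalised with de Bruijn LEVELS: variable  var i  denotes the
-- i-th variable (counting from 0, left to right) of the ambient context.
-- Hence alpha-equivalence is syntactic equality (_≡_), and contexts and
-- substitutions are lists read left to right (context extension and
-- substitution extension append at the right end).

open import Data.Nat as ℕ using (ℕ; zero; suc; _∸_; _<ᵇ_; _≡ᵇ_)
open import Data.Integer as ℤ using (ℤ; +_; -[1+_]; _⊔_; _<_)
open import Data.Bool using (if_then_else_)
open import Data.List using (List; []; _∷_; _∷ʳ_; _++_; length; map; take; drop; last)
open import Data.Maybe using (Maybe; just; nothing)
open import Data.Product using (Σ; _×_; _,_; ∃)
open import Data.Sum using (_⊎_)
open import Data.Empty using (⊥)
open import Relation.Nullary using (¬_)
open import Relation.Binary.PropositionalEquality using (_≡_; _≢_)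

mutual
  data Ty : Set where
    ⋆     : Ty
    _⟶[_]_ : Tm → Ty → Tm → Ty      -- s ⟶[ A ] t  is  s →_A t

  data Tm : Set where
    var : ℕ → Tm
    coh : List Ty → Ty → List Tm → Tm  -- coh Γ A σ  is  coh(Γ : A)[σ]

Ctx : Set
Ctx = List Ty

Sub : Set
Sub = List Tm

nth : {X : Set} → List X → ℕ → Maybe X
nth []       _       = nothing
nth (x ∷ xs) zero    = just x
nth (x ∷ xs) (suc i) = nth xs i

-- x[σ] : the entry of σ for x (raw syntax: an out-of-range variable is
-- left unchanged; this never happens for well-scoped syntax)
lookupVar : Sub → ℕ → Tm
lookupVar σ x with nth σ x
... | just t  = t
... | nothing = var x

mutual
  _[_]ty : Ty → Sub → Ty
  ⋆ [ σ ]ty = ⋆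
  (s ⟶[ A ] t) [ σ ]ty = (s [ σ ]tm) ⟶[ A [ σ ]ty ] (t [ σ ]tm)

  _[_]tm : Tm → Sub → Tm
  var x [ σ ]tm = lookupVar σ x
  coh Γ A τ [ σ ]tm = coh Γ A (τ ∘s σ)

  _∘s_ : Sub → Sub → Sub
  [] ∘s σ = []
  (t ∷ τ) ∘s σ = (t [ σ ]tm) ∷ (τ ∘s σ)

tab : ℕ → (ℕ → Tm) → Sub
tab zero    f = []
tab (suc m) f = tab m f ∷ʳ f m

idSub : Ctx → Sub
idSub Γ = tab (length Γ) var

-- Dimension (in ℤ, since dim ⋆ = -1)

-1ℤ : ℤ
-1ℤ = -[1+ 0 ]

dimTy : Ty → ℤ
dimTy ⋆ = -1ℤ
dimTy (s ⟶[ A ] t) = dimTy A ℤ.+ + 1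

dimCtx : Ctx → ℤ
dimCtx [] = -1ℤ
dimCtx (A ∷ Γ) = (dimTy A ℤ.+ + 1) ⊔ dimCtx Γ

dim+1 : Ty → ℕ
dim+1 A = ℤ.∣ dimTy A ℤ.+ + 1 ∣

mutual
  data FVty (x : ℕ) : Ty → Set where
    fv-base : ∀ {s A t} → FVty x A  → FVty x (s ⟶[ A ] t)
    fv-src  : ∀ {s A t} → FVtm x s  → FVty x (s ⟶[ A ] t)
    fv-tgt  : ∀ {s A t} → FVtm x t  → FVty x (s ⟶[ A ] t)

  data FVtm (x : ℕ) : Tm → Set where
    fv-var : FVtm x (var x)
    fv-coh : ∀ {Γ A σ} → FVsub x σ → FVtm x (coh Γ A σ)

  data FVsub (x : ℕ) : Sub → Set where
    fv-hd : ∀ {t σ} → FVtm x t  → FVsub x (t ∷ σ)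
    fv-tl : ∀ {t σ} → FVsub x σ → FVsub x (t ∷ σ)

FVctx : Ctx → ℕ → Set
FVctx Γ x = Σ Ty λ A → nth Γ x ≡ just A

data Supp (Γ : Ctx) (t : Tm) : ℕ → Set where
  supp-fv   : ∀ {x} → FVtm x t → Supp Γ t x
  supp-step : ∀ {x y A} → Supp Γ t y → nth Γ y ≡ just A → FVty x A → Supp Γ t x

_≐_ : (ℕ → Set) → (ℕ → Set) → Set
P ≐ Q = ((x : ℕ) → P x → Q x) × ((x : ℕ) → Q x → P x)

∂⁻ : Ctx → ℕ → Set
∂⁻ Γ x = Σ Ty λ A → nth Γ x ≡ just A ×
   ((dimTy A ℤ.+ + 1) < (dimCtx Γ ℤ.- + 1)
   ⊎ ((dimTy A ℤ.+ + 1) ≡ (dimCtx Γ ℤ.- + 1)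
      × ¬ (Σ ℕ λ y → y ≢ x × Σ Tm λ u → Σ Ty λ B → nth Γ y ≡ just (u ⟶[ B ] var x))))

∂⁺ : Ctx → ℕ → Set
∂⁺ Γ x = Σ Ty λ A → nth Γ x ≡ just A ×
   ((dimTy A ℤ.+ + 1) < (dimCtx Γ ℤ.- + 1)
   ⊎ ((dimTy A ℤ.+ + 1) ≡ (dimCtx Γ ℤ.- + 1)
      × ¬ (Σ ℕ λ y → y ≢ x × Σ Tm λ v → Σ Ty λ B → nth Γ y ≡ just (var x ⟶[ B ] v))))

SuppCond : Ctx → Tm → Tm → Set
SuppCond Γ s t =
  (Supp Γ s ≐ ∂⁻ Γ × Supp Γ t ≐ ∂⁺ Γ)
  ⊎ (Supp Γ s ≐ FVctx Γ × Supp Γ t ≐ FVctx Γ)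

data _⊢ps_∶_ : Ctx → ℕ → Ty → Set where
  ps-base : (⋆ ∷ []) ⊢ps 0 ∶ ⋆
  ps-intro : ∀ {Γ x A} → Γ ⊢ps x ∶ A →
    ((Γ ∷ʳ A) ∷ʳ (var x ⟶[ A ] var (length Γ)))
      ⊢ps suc (length Γ) ∶ (var x ⟶[ A ] var (length Γ))
  ps-descent : ∀ {Γ f s A y} → Γ ⊢ps f ∶ (s ⟶[ A ] var y) → Γ ⊢ps y ∶ A

_⊢ps : Ctx → Set
Γ ⊢ps = Σ ℕ λ x → Γ ⊢ps x ∶ ⋆

-- α is introduced (in the derivation) by an introduction step that is
-- immediately followed by a descent step
data LocMaxIn : ∀ {Γ x A} → Γ ⊢ps x ∶ A → ℕ → Set where
  lm-here : ∀ {Γ x A} (d : Γ ⊢ps x ∶ A) →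
    LocMaxIn (ps-descent (ps-intro d)) (suc (length Γ))
  lm-intro : ∀ {Γ x A α} {d : Γ ⊢ps x ∶ A} →
    LocMaxIn d α → LocMaxIn (ps-intro d) α
  lm-descent : ∀ {Γ f s A y α} {d : Γ ⊢ps f ∶ (s ⟶[ A ] var y)} →
    LocMaxIn d α → LocMaxIn (ps-descent d) α

LocMax : Ctx → ℕ → Set
LocMax Δ α = Σ ℕ λ x → Σ (Δ ⊢ps x ∶ ⋆) λ d → LocMaxIn d α

-- sphere k = S^(k-1); so sphere 0 = S^-1 = ⋆ and S^k = sphere (suc k).
-- d_k = var (2k), d_k' = var (2k+1)
sphere : ℕ → Ty
sphere zero = ⋆
sphere (suc k) = var (2 ℕ.* k) ⟶[ sphere k ] var (suc (2 ℕ.* k))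

disc : ℕ → Ctx
disc zero = ⋆ ∷ []
disc (suc k) = (disc k ∷ʳ sphere k) ∷ʳ sphere (suc k)

iden : ℕ → Tm
iden k = coh (disc k) (var (2 ℕ.* k) ⟶[ sphere k ] var (2 ℕ.* k)) (idSub (disc k))

IsIdentity : Tm → Set
IsIdentity t = Σ ℕ λ k → Σ Sub λ τ → t ≡ (iden k [ τ ]tm)

full : Ty → Tm → Sub
full ⋆ t = t ∷ []
full (u ⟶[ A ] v) t = (full A u ∷ʳ v) ∷ʳ t

-- Pruning a locally maximal variable α : s →_A t (its target t is the
-- variable α - 1, introduced in the same introduction step).

πsub : Ctx → ℕ → Sub
πsub Δ α with nth Δ α
... | just (s ⟶[ A ] t) =
      tab (length Δ) λ j →
        if j <ᵇ (α ∸ 1) then var j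
        else if j ≡ᵇ (α ∸ 1) then s
        else if j ≡ᵇ α then (iden (dim+1 A) [ full A s ]tm)
        else var (j ∸ 2)
... | _ = idSub Δ   -- not an arrow type: never the case for locally maximal α

-- Δ//α : delete t and α; the later types are transported along π_α
-- (which only renames t to s and renumbers the later variables)
pruneCtx : Ctx → ℕ → Ctx
pruneCtx Δ α = take (α ∸ 1) Δ ++ map (λ B → B [ πsub Δ α ]ty) (drop (suc α) Δ)

pruneSub : Sub → ℕ → Sub
pruneSub σ α = take (α ∸ 1) σ ++ drop (suc α) σ

mutual
  data _⊢ : Ctx → Set where
    ctx-∅ : [] ⊢
    ctx-ext : ∀ {Γ A} → Γ ⊢ty A → (Γ ∷ʳ A) ⊢

  data _⊢ty_ : Ctx → Ty → Set where
    ty-⋆ : ∀ {Γ} → Γ ⊢ → Γ ⊢ty ⋆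
    ty-arr : ∀ {Γ A s t} → Γ ⊢ty A → Γ ⊢tm s ∶ A → Γ ⊢tm t ∶ A →
      Γ ⊢ty (s ⟶[ A ] t)

  data _⊢tm_∶_ : Ctx → Tm → Ty → Set where
    tm-var : ∀ {Γ x A} → Γ ⊢ → nth Γ x ≡ just A → Γ ⊢tm var x ∶ A
    tm-coh : ∀ {Γ Δ A s t σ} → Δ ⊢ps → Δ ⊢ty (s ⟶[ A ] t) → Γ ⊢s σ ∶ Δ →
      SuppCond Δ s t →
      Γ ⊢tm coh Δ (s ⟶[ A ] t) σ ∶ ((s [ σ ]tm) ⟶[ A [ σ ]ty ] (t [ σ ]tm))
    tm-conv : ∀ {Γ t A B} → Γ ⊢tm t ∶ A → Γ ⊢ A ≈ty B → Γ ⊢tm t ∶ B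

  data _⊢s_∶_ : Ctx → Sub → Ctx → Set where
    sub-nil : ∀ {Γ} → Γ ⊢ → Γ ⊢s [] ∶ []
    sub-ext : ∀ {Γ Δ σ A t} → Γ ⊢s σ ∶ Δ → Δ ⊢ty A → Γ ⊢tm t ∶ (A [ σ ]ty) →
      Γ ⊢s (σ ∷ʳ t) ∶ (Δ ∷ʳ A)

  data _⊢_≈tm_ : Ctx → Tm → Tm → Set where
    eq-var : ∀ {Γ x A} → nth Γ x ≡ just A → Γ ⊢ var x ≈tm var x
    eq-sym : ∀ {Γ s t} → Γ ⊢ s ≈tm t → Γ ⊢ t ≈tm s
    eq-trans : ∀ {Γ s t u} → Γ ⊢ s ≈tm t → Γ ⊢ t ≈tm u → Γ ⊢ s ≈tm u
    eq-coh : ∀ {Γ Δ A B σ τ} → Δ ⊢ A ≈ty B → Γ ⊢ σ ≈s τ →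
      Γ ⊢ coh Δ A σ ≈tm coh Δ B τ
    eq-prune : ∀ {Γ Δ A σ B α} → Γ ⊢tm coh Δ A σ ∶ B → LocMax Δ α →
      IsIdentity (var α [ σ ]tm) →
      Γ ⊢ coh Δ A σ ≈tm coh (pruneCtx Δ α) (A [ πsub Δ α ]ty) (pruneSub σ α)
    eq-disc : ∀ {Γ n σ B} → Γ ⊢tm coh (disc (suc n)) (sphere (suc n)) σ ∶ B →
      Γ ⊢ coh (disc (suc n)) (sphere (suc n)) σ ≈tm (var (2 ℕ.* suc n) [ σ ]tm)
    eq-endo : ∀ {Γ Δ t A σ B} → Γ ⊢tm coh Δ (t ⟶[ A ] t) σ ∶ B →
      Γ ⊢ coh Δ (t ⟶[ A ] t) σ ≈tm (iden (dim+1 A) [ full A t ∘s σ ]tm)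

  data _⊢_≈ty_ : Ctx → Ty → Ty → Set where
    eq-⋆ : ∀ {Γ} → Γ ⊢ ⋆ ≈ty ⋆
    eq-arr : ∀ {Γ s s' A A' t t'} → Γ ⊢ A ≈ty A' → Γ ⊢ s ≈tm s' → Γ ⊢ t ≈tm t' →
      Γ ⊢ (s ⟶[ A ] t) ≈ty (s' ⟶[ A' ] t')

  data _⊢_≈s_ : Ctx → Sub → Sub → Set where
    eq-nil : ∀ {Γ} → Γ ⊢ [] ≈s []
    eq-cons : ∀ {Γ t t' σ σ'} → Γ ⊢ t ≈tm t' → Γ ⊢ σ ≈s σ' →
      Γ ⊢ (t ∷ σ) ≈s (t' ∷ σ')

ValidTy : Ctx → Ty → Set
ValidTy Γ A = Γ ⊢ty A

ValidTm : Ctx → Tm → Set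
ValidTm Γ t = Σ Ty λ A → Γ ⊢tm t ∶ A

ValidSub : Ctx → Sub → Set
ValidSub Γ σ = Σ Ctx λ Δ → Γ ⊢s σ ∶ Δ

-- Standard reduction, as a relation defined by structural recursion on
-- the source (so that "first applicable" can refer to irreducibility of
-- subexpressions).

PruneAt : List Ty → Ty → Sub → ℕ → Set
PruneAt Γ U σ x =
  ¬ IsIdentity (coh Γ U σ)
  × LocMax Γ x
  × IsIdentity (var x [ σ ]tm)
  × ((y : ℕ) → y ℕ.< x → LocMax Γ y → ¬ IsIdentity (var y [ σ ]tm))

IsDiscCoh : List Ty → Ty → Set
IsDiscCoh Γ U = Σ ℕ λ n → Γ ≡ disc (suc n) × U ≡ sphere (suc n)

mutual
  _⇝ty_ : Ty → Ty → Set
  ⋆ ⇝ty B = ⊥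
  (u ⟶[ T ] v) ⇝ty B =
      (Σ Ty λ T' → T ⇝ty T' × B ≡ (u ⟶[ T' ] v))
    ⊎ (¬ (Σ Ty λ T' → T ⇝ty T') × Σ Tm λ u' → u ⇝tm u' × B ≡ (u' ⟶[ T ] v))
    ⊎ (¬ (Σ Ty λ T' → T ⇝ty T') × ¬ (Σ Tm λ u' → u ⇝tm u')
       × Σ Tm λ v' → v ⇝tm v' × B ≡ (u ⟶[ T ] v'))

  _⇝tm_ : Tm → Tm → Set
  var x ⇝tm s = ⊥
  coh Γ U σ ⇝tm s =
      -- (A)
      (Σ Sub λ σ' → σ ⇝s σ' × s ≡ coh Γ U σ')
      -- (B)
    ⊎ (¬ (Σ Sub λ σ' → σ ⇝s σ')
       × Σ ℕ λ x → PruneAt Γ U σ x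
               × s ≡ coh (pruneCtx Γ x) (U [ πsub Γ x ]ty) (pruneSub σ x))
      -- (C)
    ⊎ (¬ (Σ Sub λ σ' → σ ⇝s σ') × ¬ (Σ ℕ λ x → PruneAt Γ U σ x)
       × Σ Ty λ U' → U ⇝ty U' × s ≡ coh Γ U' σ)
      -- (D)
    ⊎ (¬ (Σ Sub λ σ' → σ ⇝s σ') × ¬ (Σ ℕ λ x → PruneAt Γ U σ x)
       × ¬ (Σ Ty λ U' → U ⇝ty U')
       × IsDiscCoh Γ U × last σ ≡ just s)
      -- (E)
    ⊎ (¬ (Σ Sub λ σ' → σ ⇝s σ') × ¬ (Σ ℕ λ x → PruneAt Γ U σ x)
       × ¬ (Σ Ty λ U' → U ⇝ty U') × ¬ IsDiscCoh Γ U
       × ¬ IsIdentity (coh Γ U σ)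
       × Σ Tm λ u → Σ Ty λ T → U ≡ (u ⟶[ T ] u)
           × s ≡ (iden (dim+1 T) [ full T u ∘s σ ]tm))

  _⇝s_ : Sub → Sub → Set
  [] ⇝s τ = ⊥
  (t ∷ σ) ⇝s τ =
      (Σ Tm λ t' → t ⇝tm t' × τ ≡ (t' ∷ σ))
    ⊎ (¬ (Σ Tm λ t' → t ⇝tm t') × Σ Sub λ σ' → σ ⇝s σ' × τ ≡ (t ∷ σ'))

module Submission where

-- We assign to every raw term, type and substitution a natural-number
-- weight, relative to a valuation ρ : ℕ → ℕ of the variables, and show
-- that every standard-reduction step strictly decreases it.  A coherence
-- coh(Γ : U)[σ] weighs  c · (1 + weight of σ),  where the factor c is 1
-- for identity coherences and otherwise  (2 + |U|)(1 + length Γ), with |U|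
-- the weight of U under the canonical valuation ν_Γ of Γ (each variable
-- weighs one more than its type).  Then (A) shrinks σ, (C) shrinks U,
-- (D) returns a part of σ, (E) produces an identity whose weight is
-- bounded by |U|(1 + weight of σ), and (B) shortens Γ while ν_Γ dominates
-- the pruned valuation pushed through π_α.  The decrease needs a purely
-- syntactic invariant, well-scopedness (substitutions have the length of
-- their source context and coherence types only mention its variables),
-- which holds for valid syntax and is preserved by reduction.  Since ℕ is
-- well-founded, no infinite reduction sequence starts from valid syntax.

open import Defs
open import Data.Nat using (ℕ; zero; suc)
open import Data.Product using (Σ; _×_)
open import Relation.Nullary using (¬_)
open import Relation.Binary.PropositionalEquality using (_≡_)
open import Data.Nat using (_+_; _*_; _∸_; _≤_; _<_; _<?_; z≤n; s≤s; z<s; s≤s⁻¹; _<ᵇ_; _≡ᵇ_; >-nonZero)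
open import Data.Nat.Properties
open import Data.Nat.Induction using (<-wellFounded; <-rec)
open import Induction.WellFounded using (Acc; acc)
open import Data.Integer as ℤ using ()
open import Data.List using (List; []; _∷_; _∷ʳ_; _++_; length; map; take; drop; last; [_])
open import Data.List.Properties using (length-++; length-map; length-take; length-drop; take++drop≡id; take-all)
open import Data.Maybe as Maybe using (just; nothing)
open import Data.Product using (_,_; proj₁; proj₂)
open import Data.Sum using (_⊎_; inj₁; inj₂)
open import Data.Empty using (⊥; ⊥-elim)
open import Data.Unit using (⊤; tt)
open import Data.Bool using (true; false; if_then_else_)
open import Relation.Nullary using (Dec; yes; no)
open import Relation.Binary.Definitions using (tri<; tri≈; tri>)
open import Relation.Binary.PropositionalEquality using (_≢_; refl; sym; trans; cong; cong₂; subst; module ≡-Reasoning)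

len-snoc : ∀ {X : Set} (xs : List X) x → length (xs ∷ʳ x) ≡ suc (length xs)
len-snoc xs x = trans (length-++ xs) (+-comm (length xs) 1)

nth-just-< : ∀ {X : Set} (xs : List X) i {x} → nth xs i ≡ just x → i < length xs
nth-just-< (y ∷ xs) zero eq = s≤s z≤n
nth-just-< (y ∷ xs) (suc i) eq = s≤s (nth-just-< xs i eq)

nth-out : ∀ {X : Set} (xs : List X) i → length xs ≤ i → nth xs i ≡ nothing
nth-out [] i _ = refl
nth-out (x ∷ xs) (suc i) (s≤s p) = nth-out xs i p

nth-in : ∀ {X : Set} (xs : List X) i → i < length xs → Σ X λ x → nth xs i ≡ just x
nth-in (x ∷ xs) zero _ = x , refl
nth-in (x ∷ xs) (suc i) (s≤s p) = nth-in xs i p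

nth-++ˡ : ∀ {X : Set} (xs ys : List X) i → i < length xs → nth (xs ++ ys) i ≡ nth xs i
nth-++ˡ (x ∷ xs) ys zero _ = refl
nth-++ˡ (x ∷ xs) ys (suc i) (s≤s p) = nth-++ˡ xs ys i p

nth-++ʳ : ∀ {X : Set} (xs ys : List X) i → nth (xs ++ ys) (length xs + i) ≡ nth ys i
nth-++ʳ [] ys i = refl
nth-++ʳ (x ∷ xs) ys i = nth-++ʳ xs ys i

nth-snoc-len : ∀ {X : Set} (xs : List X) y → nth (xs ∷ʳ y) (length xs) ≡ just y
nth-snoc-len xs y = trans (cong (nth (xs ∷ʳ y)) (sym (+-identityʳ (length xs)))) (nth-++ʳ xs [ y ] 0)

nth-snoc-in : ∀ {X : Set} (xs : List X) y i → i < length xs → nth (xs ∷ʳ y) i ≡ nth xs i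
nth-snoc-in xs y i p = nth-++ˡ xs [ y ] i p

nth-take : ∀ {X : Set} (xs : List X) n i → i < n → nth (take n xs) i ≡ nth xs i
nth-take [] (suc n) i p = refl
nth-take (x ∷ xs) (suc n) zero p = refl
nth-take (x ∷ xs) (suc n) (suc i) (s≤s p) = nth-take xs n i p

nth-drop : ∀ {X : Set} (xs : List X) n i → nth (drop n xs) i ≡ nth xs (n + i)
nth-drop xs zero i = refl
nth-drop [] (suc n) i = refl
nth-drop (x ∷ xs) (suc n) i = nth-drop xs n i

nth-map : ∀ {X Y : Set} (f : X → Y) (xs : List X) i → nth (map f xs) i ≡ Maybe.map f (nth xs i)
nth-map f [] i = refl
nth-map f (x ∷ xs) zero = refl
nth-map f (x ∷ xs) (suc i) = nth-map f xs i

take-snoc : ∀ {X : Set} (xs : List X) m {x} → nth xs m ≡ just x → take (suc m) xs ≡ take m xs ∷ʳ x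
take-snoc (y ∷ xs) zero refl = refl
take-snoc (y ∷ xs) (suc m) eq = cong (y ∷_) (take-snoc xs m eq)

last-nth : ∀ {X : Set} (xs : List X) {x} → last xs ≡ just x → Σ ℕ λ j → nth xs j ≡ just x
last-nth (y ∷ []) refl = 0 , refl
last-nth (y ∷ z ∷ xs) eq with last-nth (z ∷ xs) eq
... | j , e = suc j , e

length-cut : ∀ {X : Set} a (xs ys : List X) → suc a < length xs →
  length ys ≡ length (drop (suc (suc a)) xs) → length (take a xs ++ ys) ≡ length xs ∸ 2
length-cut a xs ys a+1<n eq = begin
    length (take a xs ++ ys)                  ≡⟨ length-++ (take a xs) ⟩
    length (take a xs) + length ys            ≡⟨ cong₂ _+_ (trans (length-take a xs) (m≤n⇒m⊓n≡m a≤n)) eq ⟩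
    a + length (drop (suc (suc a)) xs)        ≡⟨ cong (a +_) (length-drop (suc (suc a)) xs) ⟩
    a + (length xs ∸ (2 + a))                 ≡⟨ cong (a +_) (sym (∸-+-assoc (length xs) 2 a)) ⟩
    a + (length xs ∸ 2 ∸ a)                   ≡⟨ m+[n∸m]≡n a≤n-2 ⟩
    length xs ∸ 2                             ∎
  where
    open ≡-Reasoning
    a≤n : a ≤ length xs
    a≤n = ≤-trans (n≤1+n a) (<⇒≤ a+1<n)
    a≤n-2 : a ≤ length xs ∸ 2
    a≤n-2 = ≤-trans (≤-reflexive (sym (m+n∸m≡n 2 a))) (∸-monoˡ-≤ 2 a+1<n)

lookup-just : ∀ σ i {t} → nth σ i ≡ just t → lookupVar σ i ≡ t
lookup-just σ i eq with nth σ i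
lookup-just σ i refl | just _ = refl

lookup-out : ∀ σ i → length σ ≤ i → lookupVar σ i ≡ var i
lookup-out σ i p with nth σ i | nth-out σ i p
... | nothing | refl = refl

tab-len : ∀ n f → length (tab n f) ≡ n
tab-len zero f = refl
tab-len (suc n) f = trans (len-snoc (tab n f) (f n)) (cong suc (tab-len n f))

nth-tab : ∀ n f i → i < n → nth (tab n f) i ≡ just (f i)
nth-tab (suc n) f i p with m≤n⇒m<n∨m≡n (s≤s⁻¹ p)
... | inj₁ q = trans (nth-snoc-in (tab n f) (f n) i (subst (i <_) (sym (tab-len n f)) q)) (nth-tab n f i q)
... | inj₂ refl = trans (cong (nth (tab n f ∷ʳ f n)) (sym (tab-len n f))) (nth-snoc-len (tab n f) (f n))

lookup-tab-in : ∀ n f i → i < n → lookupVar (tab n f) i ≡ f i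
lookup-tab-in n f i p = lookup-just (tab n f) i (nth-tab n f i p)

lookup-tab-out : ∀ n f i → n ≤ i → lookupVar (tab n f) i ≡ var i
lookup-tab-out n f i p = lookup-out (tab n f) i (subst (_≤ i) (sym (tab-len n f)) p)

∘s-++ : ∀ τ τ' σ → (τ ++ τ') ∘s σ ≡ (τ ∘s σ) ++ (τ' ∘s σ)
∘s-++ [] τ' σ = refl
∘s-++ (t ∷ τ) τ' σ = cong (_ ∷_) (∘s-++ τ τ' σ)

len-∘s : ∀ τ σ → length (τ ∘s σ) ≡ length τ
len-∘s [] σ = refl
len-∘s (t ∷ τ) σ = cong suc (len-∘s τ σ)

tabvar∘ : ∀ m σ → m ≤ length σ → tab m var ∘s σ ≡ take m σ
tabvar∘ zero σ p = refl
tabvar∘ (suc m) σ p with nth-in σ m p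
... | t , eq = begin
    (tab m var ∷ʳ var m) ∘s σ          ≡⟨ ∘s-++ (tab m var) [ var m ] σ ⟩
    (tab m var ∘s σ) ∷ʳ lookupVar σ m  ≡⟨ cong₂ _∷ʳ_ (tabvar∘ m σ (<⇒≤ p)) (lookup-just σ m eq) ⟩
    take m σ ∷ʳ t                      ≡⟨ sym (take-snoc σ m eq) ⟩
    take (suc m) σ                     ∎
  where open ≡-Reasoning

idSub∘ : ∀ Γ σ → length Γ ≡ length σ → idSub Γ ∘s σ ≡ σ
idSub∘ Γ σ eq = trans (tabvar∘ (length Γ) σ (≤-reflexive eq)) (take-all (length Γ) σ (≤-reflexive (sym eq)))


dimP : ∀ A → dimTy A ℤ.+ ℤ.+ 1 ≡ ℤ.+ dim+1 A
dimP ⋆ = refl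
dimP (s ⟶[ A ] t) rewrite dimP A = refl

dim-suc : ∀ s A t → dim+1 (s ⟶[ A ] t) ≡ suc (dim+1 A)
dim-suc s A t rewrite dimP A = +-comm (dim+1 A) 1

two-suc : ∀ k → 2 * suc k ≡ suc (suc (2 * k))
two-suc k = cong suc (+-suc k (k + 0))

disc-len : ∀ k → length (disc k) ≡ suc (2 * k)
disc-len zero = refl
disc-len (suc k) = begin
    length ((disc k ∷ʳ sphere k) ∷ʳ sphere (suc k))  ≡⟨ len-snoc (disc k ∷ʳ sphere k) _ ⟩
    suc (length (disc k ∷ʳ sphere k))                ≡⟨ cong suc (len-snoc (disc k) _) ⟩
    suc (suc (length (disc k)))                      ≡⟨ cong (λ n → suc (suc n)) (disc-len k) ⟩
    suc (suc (suc (2 * k)))                          ≡⟨ cong suc (sym (two-suc k)) ⟩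
    suc (2 * suc k)                                  ∎
  where open ≡-Reasoning

full-len : ∀ T u → length (full T u) ≡ suc (2 * dim+1 T)
full-len ⋆ u = refl
full-len (s ⟶[ A ] t) u = begin
    length ((full A s ∷ʳ t) ∷ʳ u)          ≡⟨ len-snoc (full A s ∷ʳ t) u ⟩
    suc (length (full A s ∷ʳ t))           ≡⟨ cong suc (len-snoc (full A s) t) ⟩
    suc (suc (length (full A s)))          ≡⟨ cong (λ n → suc (suc n)) (full-len A s) ⟩
    suc (suc (suc (2 * dim+1 A)))          ≡⟨ cong suc (sym (two-suc (dim+1 A))) ⟩
    suc (2 * suc (dim+1 A))                ≡⟨ cong (λ n → suc (2 * n)) (sym (dim-suc s A t)) ⟩
    suc (2 * dim+1 (s ⟶[ A ] t))           ∎
  where open ≡-Reasoning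

-- Recognising identity coherences.  Syntax has decidable equality, so we
-- can decide whether a coherence is literally  i_k[τ].

mutual
  _≟ty_ : (A B : Ty) → Dec (A ≡ B)
  ⋆ ≟ty ⋆ = yes refl
  ⋆ ≟ty (_ ⟶[ _ ] _) = no λ ()
  (_ ⟶[ _ ] _) ≟ty ⋆ = no λ ()
  (s ⟶[ A ] t) ≟ty (s' ⟶[ A' ] t') with s ≟tm s' | A ≟ty A' | t ≟tm t'
  ... | yes refl | yes refl | yes refl = yes refl
  ... | no p | _ | _ = no λ { refl → p refl }
  ... | yes _ | no p | _ = no λ { refl → p refl }
  ... | yes _ | yes _ | no p = no λ { refl → p refl }

  _≟tm_ : (s t : Tm) → Dec (s ≡ t)
  var x ≟tm var y with x ≟ y
  ... | yes refl = yes refl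
  ... | no p = no λ { refl → p refl }
  var _ ≟tm coh _ _ _ = no λ ()
  coh _ _ _ ≟tm var _ = no λ ()
  coh Γ U σ ≟tm coh Γ' U' σ' with Γ ≟ctx Γ' | U ≟ty U' | σ ≟sub σ'
  ... | yes refl | yes refl | yes refl = yes refl
  ... | no p | _ | _ = no λ { refl → p refl }
  ... | yes _ | no p | _ = no λ { refl → p refl }
  ... | yes _ | yes _ | no p = no λ { refl → p refl }

  _≟ctx_ : (Γ Δ : List Ty) → Dec (Γ ≡ Δ)
  [] ≟ctx [] = yes refl
  [] ≟ctx (_ ∷ _) = no λ ()
  (_ ∷ _) ≟ctx [] = no λ ()
  (A ∷ Γ) ≟ctx (B ∷ Δ) with A ≟ty B | Γ ≟ctx Δ
  ... | yes refl | yes refl = yes refl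
  ... | no p | _ = no λ { refl → p refl }
  ... | yes _ | no p = no λ { refl → p refl }

  _≟sub_ : (σ τ : List Tm) → Dec (σ ≡ τ)
  [] ≟sub [] = yes refl
  [] ≟sub (_ ∷ _) = no λ ()
  (_ ∷ _) ≟sub [] = no λ ()
  (t ∷ σ) ≟sub (u ∷ τ) with t ≟tm u | σ ≟sub τ
  ... | yes refl | yes refl = yes refl
  ... | no p | _ = no λ { refl → p refl }
  ... | yes _ | no p = no λ { refl → p refl }

idty : ℕ → Ty
idty k = var (2 * k) ⟶[ sphere k ] var (2 * k)

IdForm : Ctx → Ty → ℕ → Set
IdForm Γ U n = Σ ℕ λ k → Γ ≡ disc k × U ≡ idty k × n ≡ suc (2 * k)

-- the only candidate disc index for a context of length 2k+1
half : ℕ → ℕ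
half zero = zero
half (suc zero) = zero
half (suc (suc n)) = suc (half n)

half-odd : ∀ k → half (suc (2 * k)) ≡ k
half-odd zero = refl
half-odd (suc k) = trans (cong (λ m → half (suc m)) (two-suc k)) (cong suc (half-odd k))

IdForm-canonical : ∀ {Γ U n} → IdForm Γ U n →
  Γ ≡ disc (half (length Γ)) × U ≡ idty (half (length Γ)) × n ≡ suc (2 * half (length Γ))
IdForm-canonical (k , refl , refl , refl) rewrite disc-len k | half-odd k = refl , refl , refl

IdForm? : ∀ Γ U n → Dec (IdForm Γ U n)
IdForm? Γ U n with Γ ≟ctx disc k | U ≟ty idty k | n ≟ suc (2 * k)
  where k = half (length Γ)
... | yes p | yes q | yes r = yes (_ , p , q , r)
... | no p | _ | _ = no λ f → p (proj₁ (IdForm-canonical f))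
... | yes _ | no q | _ = no λ f → q (proj₁ (proj₂ (IdForm-canonical f)))
... | yes _ | yes _ | no r = no λ f → r (proj₂ (proj₂ (IdForm-canonical f)))

iden-eq : ∀ k τ → length τ ≡ suc (2 * k) → iden k [ τ ]tm ≡ coh (disc k) (idty k) τ
iden-eq k τ e = cong (coh (disc k) (idty k)) (idSub∘ (disc k) τ (trans (disc-len k) (sym e)))

IdForm→IsIdentity : ∀ Γ U σ → IdForm Γ U (length σ) → IsIdentity (coh Γ U σ)
IdForm→IsIdentity .(disc k) .(idty k) σ (k , refl , refl , eq) = k , σ , sym (iden-eq k σ eq)

sphere-irreducible : ∀ k B → ¬ (sphere k ⇝ty B)
sphere-irreducible (suc k) B (inj₁ (T' , r , _)) = sphere-irreducible k T' r
sphere-irreducible (suc k) B (inj₂ (inj₁ (_ , _ , () , _)))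
sphere-irreducible (suc k) B (inj₂ (inj₂ (_ , _ , _ , () , _)))

idty-irreducible : ∀ k B → ¬ (idty k ⇝ty B)
idty-irreducible k B (inj₁ (T' , r , _)) = sphere-irreducible k T' r
idty-irreducible k B (inj₂ (inj₁ (_ , _ , () , _)))
idty-irreducible k B (inj₂ (inj₂ (_ , _ , _ , () , _)))

-- A valuation  ρ : ℕ → ℕ  weighs the variables; ctxVal Γ is
-- the canonical valuation of Γ, in which the i-th variable of type B weighs
-- 1 + (weight of B), and every variable outside Γ weighs 1.

valOf : List ℕ → ℕ → ℕ
valOf [] i = 1
valOf (v ∷ vs) zero = suc v
valOf (v ∷ vs) (suc i) = valOf vs i

mutual
  wTm : Tm → (ℕ → ℕ) → ℕ
  wTm (var x) ρ = ρ x
  wTm (coh Γ U σ) ρ = cohFactor Γ U (length σ) * suc (wSub σ ρ)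

  wSub : Sub → (ℕ → ℕ) → ℕ
  wSub [] ρ = 0
  wSub (t ∷ σ) ρ = wTm t ρ + wSub σ ρ

  wTy : Ty → (ℕ → ℕ) → ℕ
  wTy ⋆ ρ = 0
  wTy (s ⟶[ A ] t) ρ = wTm s ρ + wTy A ρ + wTm t ρ

  cohFactor : Ctx → Ty → ℕ → ℕ
  cohFactor Γ U n with IdForm? Γ U n
  ... | yes _ = 1
  ... | no _ = cohWeight Γ U

  cohWeight : Ctx → Ty → ℕ
  cohWeight Γ U = (2 + wTy U (ctxVal Γ)) * suc (length Γ)

  ctxVal : Ctx → ℕ → ℕ
  ctxVal Γ = valOf (ctxWeights [] Γ)

  ctxWeights : List ℕ → Ctx → List ℕ
  ctxWeights ws [] = ws
  ctxWeights ws (A ∷ Γ) = ctxWeights (ws ∷ʳ wTy A (valOf ws)) Γ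

ones : ℕ → ℕ
ones _ = 1

pushVal : Sub → (ℕ → ℕ) → ℕ → ℕ
pushVal σ ρ j = wTm (lookupVar σ j) ρ

valOf-pos : ∀ l i → 1 ≤ valOf l i
valOf-pos [] i = s≤s z≤n
valOf-pos (v ∷ l) zero = s≤s z≤n
valOf-pos (v ∷ l) (suc i) = valOf-pos l i

valOf-out : ∀ l i → length l ≤ i → valOf l i ≡ 1
valOf-out [] i p = refl
valOf-out (x ∷ l) (suc i) (s≤s p) = valOf-out l i p

valOf-snoc-in : ∀ l v i → i < length l → valOf (l ∷ʳ v) i ≡ valOf l i
valOf-snoc-in (x ∷ l) v zero p = refl
valOf-snoc-in (x ∷ l) v (suc i) (s≤s p) = valOf-snoc-in l v i p

valOf-snoc-len : ∀ l v → valOf (l ∷ʳ v) (length l) ≡ suc v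
valOf-snoc-len [] v = refl
valOf-snoc-len (x ∷ l) v = valOf-snoc-len l v

cohWeight-pos : ∀ Γ U → 1 ≤ cohWeight Γ U
cohWeight-pos Γ U = s≤s z≤n

cohFactor-≤ : ∀ Γ U n → cohFactor Γ U n ≤ cohWeight Γ U
cohFactor-≤ Γ U n with IdForm? Γ U n
... | yes _ = cohWeight-pos Γ U
... | no _ = ≤-refl

cohFactor-pos : ∀ Γ U n → 1 ≤ cohFactor Γ U n
cohFactor-pos Γ U n with IdForm? Γ U n
... | yes _ = ≤-refl
... | no _ = cohWeight-pos Γ U

cohFactor-nonId : ∀ Γ U n → ¬ IdForm Γ U n → cohFactor Γ U n ≡ cohWeight Γ U
cohFactor-nonId Γ U n ¬p with IdForm? Γ U n
... | yes p = ⊥-elim (¬p p)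
... | no _ = refl

cohFactor-id : ∀ Γ U n → IdForm Γ U n → cohFactor Γ U n ≡ 1
cohFactor-id Γ U n p with IdForm? Γ U n
... | yes _ = refl
... | no ¬p = ⊥-elim (¬p p)

mutual
  mono-tm : ∀ t {ρ ρ'} → (∀ x → FVtm x t → ρ x ≤ ρ' x) → wTm t ρ ≤ wTm t ρ'
  mono-tm (var x) p = p x fv-var
  mono-tm (coh Γ U σ) p = *-monoʳ-≤ (cohFactor Γ U (length σ)) (s≤s (mono-sub σ λ x q → p x (fv-coh q)))

  mono-sub : ∀ σ {ρ ρ'} → (∀ x → FVsub x σ → ρ x ≤ ρ' x) → wSub σ ρ ≤ wSub σ ρ'
  mono-sub [] p = z≤n
  mono-sub (t ∷ σ) p = +-mono-≤ (mono-tm t λ x q → p x (fv-hd q)) (mono-sub σ λ x q → p x (fv-tl q))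

mono-ty : ∀ A {ρ ρ'} → (∀ x → FVty x A → ρ x ≤ ρ' x) → wTy A ρ ≤ wTy A ρ'
mono-ty ⋆ p = z≤n
mono-ty (s ⟶[ A ] t) p =
  +-mono-≤ (+-mono-≤ (mono-tm s λ x q → p x (fv-src q)) (mono-ty A λ x q → p x (fv-base q)))
           (mono-tm t λ x q → p x (fv-tgt q))

dep-ty : ∀ A {ρ ρ'} → (∀ x → FVty x A → ρ x ≡ ρ' x) → wTy A ρ ≡ wTy A ρ'
dep-ty A p = ≤-antisym (mono-ty A λ x q → ≤-reflexive (p x q)) (mono-ty A λ x q → ≤-reflexive (sym (p x q)))

mutual
  wTm-subst : ∀ t σ ρ → wTm (t [ σ ]tm) ρ ≡ wTm t (pushVal σ ρ)
  wTm-subst (var x) σ ρ = refl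
  wTm-subst (coh Γ U τ) σ ρ = cong₂ (λ n m → cohFactor Γ U n * suc m) (len-∘s τ σ) (wSub-subst τ σ ρ)

  wSub-subst : ∀ τ σ ρ → wSub (τ ∘s σ) ρ ≡ wSub τ (pushVal σ ρ)
  wSub-subst [] σ ρ = refl
  wSub-subst (t ∷ τ) σ ρ = cong₂ _+_ (wTm-subst t σ ρ) (wSub-subst τ σ ρ)

wTy-subst : ∀ A σ ρ → wTy (A [ σ ]ty) ρ ≡ wTy A (pushVal σ ρ)
wTy-subst ⋆ σ ρ = refl
wTy-subst (s ⟶[ A ] t) σ ρ = cong₂ _+_ (cong₂ _+_ (wTm-subst s σ ρ) (wTy-subst A σ ρ)) (wTm-subst t σ ρ)

wSub-++ : ∀ xs ys ρ → wSub (xs ++ ys) ρ ≡ wSub xs ρ + wSub ys ρ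
wSub-++ [] ys ρ = refl
wSub-++ (x ∷ xs) ys ρ = trans (cong (wTm x ρ +_) (wSub-++ xs ys ρ)) (sym (+-assoc (wTm x ρ) _ _))

wSub-snoc : ∀ xs y ρ → wSub (xs ∷ʳ y) ρ ≡ wSub xs ρ + wTm y ρ
wSub-snoc xs y ρ = trans (wSub-++ xs [ y ] ρ) (cong (wSub xs ρ +_) (+-identityʳ (wTm y ρ)))

wSub-nth : ∀ σ j {t} ρ → nth σ j ≡ just t → wTm t ρ ≤ wSub σ ρ
wSub-nth (u ∷ σ) zero ρ refl = m≤m+n (wTm u ρ) _
wSub-nth (u ∷ σ) (suc j) ρ eq = ≤-trans (wSub-nth σ j ρ eq) (m≤n+m _ (wTm u ρ))

wSub-full : ∀ T u ρ → wSub (full T u) ρ ≡ wTy T ρ + wTm u ρ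
wSub-full ⋆ u ρ = +-identityʳ (wTm u ρ)
wSub-full (s ⟶[ A ] t) u ρ = begin
    wSub ((full A s ∷ʳ t) ∷ʳ u) ρ          ≡⟨ wSub-snoc (full A s ∷ʳ t) u ρ ⟩
    wSub (full A s ∷ʳ t) ρ + wTm u ρ       ≡⟨ cong (_+ wTm u ρ) (wSub-snoc (full A s) t ρ) ⟩
    wSub (full A s) ρ + wTm t ρ + wTm u ρ  ≡⟨ cong (λ m → m + wTm t ρ + wTm u ρ) (wSub-full A s ρ) ⟩
    wTy A ρ + wTm s ρ + wTm t ρ + wTm u ρ  ≡⟨ cong (λ m → m + wTm t ρ + wTm u ρ) (+-comm (wTy A ρ) (wTm s ρ)) ⟩
    wTm s ρ + wTy A ρ + wTm t ρ + wTm u ρ  ∎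
  where open ≡-Reasoning

wSub-drop-mono : ∀ m n σ ρ → m ≤ n → wSub (drop n σ) ρ ≤ wSub (drop m σ) ρ
wSub-drop-mono zero zero σ ρ _ = ≤-refl
wSub-drop-mono zero (suc n) [] ρ _ = ≤-refl
wSub-drop-mono zero (suc n) (t ∷ σ) ρ _ = ≤-trans (wSub-drop-mono zero n σ ρ z≤n) (m≤n+m _ _)
wSub-drop-mono (suc m) (suc n) [] ρ _ = ≤-refl
wSub-drop-mono (suc m) (suc n) (t ∷ σ) ρ (s≤s p) = wSub-drop-mono m n σ ρ p

wSub-prune : ∀ σ α ρ → wSub (pruneSub σ α) ρ ≤ wSub σ ρ
wSub-prune σ α ρ = begin
    wSub (pruneSub σ α) ρ                               ≡⟨ wSub-++ (take (α ∸ 1) σ) (drop (suc α) σ) ρ ⟩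
    wSub (take (α ∸ 1) σ) ρ + wSub (drop (suc α) σ) ρ   ≤⟨ +-monoʳ-≤ (wSub (take (α ∸ 1) σ) ρ)
                                                            (wSub-drop-mono (α ∸ 1) (suc α) σ ρ α-1≤α+1) ⟩
    wSub (take (α ∸ 1) σ) ρ + wSub (drop (α ∸ 1) σ) ρ   ≡⟨ sym (wSub-++ (take (α ∸ 1) σ) (drop (α ∸ 1) σ) ρ) ⟩
    wSub (take (α ∸ 1) σ ++ drop (α ∸ 1) σ) ρ           ≡⟨ cong (λ τ → wSub τ ρ) (take++drop≡id (α ∸ 1) σ) ⟩
    wSub σ ρ                                            ∎
  where
    open ≤-Reasoning
    α-1≤α+1 : α ∸ 1 ≤ suc α
    α-1≤α+1 = ≤-trans (m∸n≤m α 1) (n≤1+n α)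

wTm-iden : ∀ k τ ρ → length τ ≡ suc (2 * k) → wTm (iden k [ τ ]tm) ρ ≡ suc (wSub τ ρ)
wTm-iden k τ ρ e = begin
    wTm (iden k [ τ ]tm) ρ                                  ≡⟨ cong (λ t → wTm t ρ) (iden-eq k τ e) ⟩
    cohFactor (disc k) (idty k) (length τ) * suc (wSub τ ρ) ≡⟨ cong (_* suc (wSub τ ρ)) (cohFactor-id _ _ _ (k , refl , refl , e)) ⟩
    1 * suc (wSub τ ρ)                                      ≡⟨ *-identityˡ _ ⟩
    suc (wSub τ ρ)                                          ∎
  where open ≡-Reasoning

mutual
  bound-tm : ∀ t ρ b → (∀ x → FVtm x t → ρ x ≤ suc b) → wTm t ρ ≤ wTm t ones * suc b
  bound-tm (var x) ρ b p = ≤-trans (p x fv-var) (≤-reflexive (sym (*-identityˡ _)))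
  bound-tm (coh Γ U σ) ρ b p = begin
      h * suc (wSub σ ρ)     ≤⟨ *-monoʳ-≤ h (s≤s (bound-sub σ ρ b λ x q → p x (fv-coh q))) ⟩
      h * suc (a * suc b)    ≤⟨ *-monoʳ-≤ h (+-monoˡ-≤ (a * suc b) (s≤s (z≤n {b}))) ⟩
      h * (suc a * suc b)    ≡⟨ sym (*-assoc h (suc a) (suc b)) ⟩
      h * suc a * suc b      ∎
    where
      open ≤-Reasoning
      h = cohFactor Γ U (length σ)
      a = wSub σ ones

  bound-sub : ∀ σ ρ b → (∀ x → FVsub x σ → ρ x ≤ suc b) → wSub σ ρ ≤ wSub σ ones * suc b
  bound-sub [] ρ b p = z≤n
  bound-sub (t ∷ σ) ρ b p =
    ≤-trans (+-mono-≤ (bound-tm t ρ b λ x q → p x (fv-hd q)) (bound-sub σ ρ b λ x q → p x (fv-tl q)))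
            (≤-reflexive (sym (*-distribʳ-+ (suc b) (wTm t ones) (wSub σ ones))))

ctxWeights-++ : ∀ ws Γ Δ → ctxWeights ws (Γ ++ Δ) ≡ ctxWeights (ctxWeights ws Γ) Δ
ctxWeights-++ ws [] Δ = refl
ctxWeights-++ ws (A ∷ Γ) Δ = ctxWeights-++ (ws ∷ʳ wTy A (valOf ws)) Γ Δ

ctxWeights-len : ∀ ws Γ → length (ctxWeights ws Γ) ≡ length ws + length Γ
ctxWeights-len ws [] = sym (+-identityʳ _)
ctxWeights-len ws (A ∷ Γ) = trans (ctxWeights-len (ws ∷ʳ wTy A (valOf ws)) Γ)
  (trans (cong (_+ length Γ) (len-snoc ws _)) (sym (+-suc (length ws) (length Γ))))

ctxWeights-prefix : ∀ ws Γ i → i < length ws → valOf (ctxWeights ws Γ) i ≡ valOf ws i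
ctxWeights-prefix ws [] i p = refl
ctxWeights-prefix ws (A ∷ Γ) i p =
  trans (ctxWeights-prefix (ws ∷ʳ wTy A (valOf ws)) Γ i (subst (i <_) (sym (len-snoc ws _)) (≤-trans p (n≤1+n _))))
        (valOf-snoc-in ws _ i p)

ctxWeights-take-len : ∀ Γ n → n ≤ length Γ → length (ctxWeights [] (take n Γ)) ≡ n
ctxWeights-take-len Γ n p = trans (ctxWeights-len [] (take n Γ)) (trans (length-take n Γ) (m≤n⇒m⊓n≡m p))

ctxVal-prefix : ∀ Γ n → n ≤ length Γ → ∀ x → x < n → ctxVal Γ x ≡ ctxVal (take n Γ) x
ctxVal-prefix Γ n le x lt = begin
    valOf (ctxWeights [] Γ) x                                    ≡⟨ cong (λ G → valOf (ctxWeights [] G) x) (sym (take++drop≡id n Γ)) ⟩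
    valOf (ctxWeights [] (take n Γ ++ drop n Γ)) x               ≡⟨ cong (λ l → valOf l x) (ctxWeights-++ [] (take n Γ) (drop n Γ)) ⟩
    valOf (ctxWeights (ctxWeights [] (take n Γ)) (drop n Γ)) x   ≡⟨ ctxWeights-prefix _ (drop n Γ) x
                                                                      (subst (x <_) (sym (ctxWeights-take-len Γ n le)) lt) ⟩
    valOf (ctxWeights [] (take n Γ)) x                           ∎
  where open ≡-Reasoning

ctxVal-var : ∀ Γ i B → nth Γ i ≡ just B → (∀ x → FVty x B → x < i) → ctxVal Γ i ≡ suc (wTy B (ctxVal Γ))
ctxVal-var Γ i B e sc = begin
    ctxVal Γ i                                 ≡⟨ ctxVal-prefix Γ (suc i) i<Γ i ≤-refl ⟩
    valOf (ctxWeights [] (take (suc i) Γ)) i   ≡⟨ cong (λ G → valOf (ctxWeights [] G) i) (take-snoc Γ i e) ⟩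
    valOf (ctxWeights [] (take i Γ ∷ʳ B)) i    ≡⟨ cong (λ l → valOf l i) (ctxWeights-++ [] (take i Γ) [ B ]) ⟩
    valOf (P ∷ʳ wTy B (valOf P)) i             ≡⟨ cong (valOf (P ∷ʳ wTy B (valOf P))) (sym lenP) ⟩
    valOf (P ∷ʳ wTy B (valOf P)) (length P)    ≡⟨ valOf-snoc-len P _ ⟩
    suc (wTy B (valOf P))                      ≡⟨ cong suc (dep-ty B λ x p → sym (ctxVal-prefix Γ i (<⇒≤ i<Γ) x (sc x p))) ⟩
    suc (wTy B (ctxVal Γ))                     ∎
  where
    open ≡-Reasoning
    i<Γ = nth-just-< Γ i e
    P = ctxWeights [] (take i Γ)
    lenP : length P ≡ i
    lenP = ctxWeights-take-len Γ i (<⇒≤ i<Γ)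

ctxVal-out : ∀ Γ i → length Γ ≤ i → ctxVal Γ i ≡ 1
ctxVal-out Γ i p = valOf-out (ctxWeights [] Γ) i (subst (_≤ i) (sym (ctxWeights-len [] Γ)) p)

ScopedTm : ℕ → Tm → Set
ScopedTm n t = ∀ x → FVtm x t → x < n

ScopedTy : ℕ → Ty → Set
ScopedTy n A = ∀ x → FVty x A → x < n

ScopedSub : ℕ → Sub → Set
ScopedSub n σ = ∀ x → FVsub x σ → x < n

mutual
  fv-subst-tm : ∀ t σ x → FVtm x (t [ σ ]tm) → Σ ℕ λ j → FVtm j t × FVtm x (lookupVar σ j)
  fv-subst-tm (var y) σ x p = y , fv-var , p
  fv-subst-tm (coh Γ U τ) σ x (fv-coh q) with fv-subst-sub τ σ x q
  ... | j , r , s = j , fv-coh r , s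

  fv-subst-sub : ∀ τ σ x → FVsub x (τ ∘s σ) → Σ ℕ λ j → FVsub j τ × FVtm x (lookupVar σ j)
  fv-subst-sub (t ∷ τ) σ x (fv-hd q) with fv-subst-tm t σ x q
  ... | j , r , s = j , fv-hd r , s
  fv-subst-sub (t ∷ τ) σ x (fv-tl q) with fv-subst-sub τ σ x q
  ... | j , r , s = j , fv-tl r , s

fv-subst-ty : ∀ A σ x → FVty x (A [ σ ]ty) → Σ ℕ λ j → FVty j A × FVtm x (lookupVar σ j)
fv-subst-ty (s ⟶[ A ] t) σ x (fv-base q) with fv-subst-ty A σ x q
... | j , r , w = j , fv-base r , w
fv-subst-ty (s ⟶[ A ] t) σ x (fv-src q) with fv-subst-tm s σ x q
... | j , r , w = j , fv-src r , w
fv-subst-ty (s ⟶[ A ] t) σ x (fv-tgt q) with fv-subst-tm t σ x q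
... | j , r , w = j , fv-tgt r , w

fv-nth : ∀ σ j {t} x → nth σ j ≡ just t → FVtm x t → FVsub x σ
fv-nth (u ∷ σ) zero x refl p = fv-hd p
fv-nth (u ∷ σ) (suc j) x eq p = fv-tl (fv-nth σ j x eq p)

fv-subst-scoped : ∀ τ σ x → ScopedSub (length σ) τ → FVsub x (τ ∘s σ) → FVsub x σ
fv-subst-scoped τ σ x sc p with fv-subst-sub τ σ x p
... | j , r , w with nth-in σ j (sc j r)
...   | t , eq = fv-nth σ j x eq (subst (FVtm x) (lookup-just σ j eq) w)

fv-++ : ∀ xs ys x → FVsub x (xs ++ ys) → FVsub x xs ⊎ FVsub x ys
fv-++ [] ys x p = inj₂ p
fv-++ (t ∷ xs) ys x (fv-hd p) = inj₁ (fv-hd p)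
fv-++ (t ∷ xs) ys x (fv-tl p) with fv-++ xs ys x p
... | inj₁ q = inj₁ (fv-tl q)
... | inj₂ q = inj₂ q

fv-take : ∀ n σ x → FVsub x (take n σ) → FVsub x σ
fv-take (suc n) (t ∷ σ) x (fv-hd p) = fv-hd p
fv-take (suc n) (t ∷ σ) x (fv-tl p) = fv-tl (fv-take n σ x p)

fv-drop : ∀ n σ x → FVsub x (drop n σ) → FVsub x σ
fv-drop zero σ x p = p
fv-drop (suc n) (t ∷ σ) x p = fv-tl (fv-drop n σ x p)

fv-prune : ∀ σ α x → FVsub x (pruneSub σ α) → FVsub x σ
fv-prune σ α x p with fv-++ (take (α ∸ 1) σ) (drop (suc α) σ) x p
... | inj₁ q = fv-take (α ∸ 1) σ x q
... | inj₂ q = fv-drop (suc α) σ x q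

fv-full : ∀ T u v → FVsub v (full T u) → FVty v T ⊎ FVtm v u
fv-full ⋆ u v (fv-hd p) = inj₂ p
fv-full (s ⟶[ A ] t) u v p with fv-++ (full A s ∷ʳ t) [ u ] v p
... | inj₂ (fv-hd q) = inj₂ q
... | inj₁ q with fv-++ (full A s) [ t ] v q
...   | inj₂ (fv-hd r) = inj₁ (fv-tgt r)
...   | inj₁ r with fv-full A s v r
...     | inj₁ e = inj₁ (fv-base e)
...     | inj₂ e = inj₁ (fv-src e)

scoped-full : ∀ n T u → ScopedTy n T → ScopedTm n u → ScopedSub n (full T u)
scoped-full n T u a b v p with fv-full T u v p
... | inj₁ q = a v q
... | inj₂ q = b v q

fv-iden : ∀ k τ v → length τ ≡ suc (2 * k) → FVtm v (iden k [ τ ]tm) → FVsub v τ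
fv-iden k τ v e p with subst (FVtm v) (iden-eq k τ e) p
... | fv-coh q = q

-- Well-scopedness: the invariant under which the weight decreases.  Every
-- coherence coh(Γ : U)[σ] in it has |σ| = |Γ| and U mentions only
-- variables of Γ.

mutual
  WsTm : Tm → Set
  WsTm (var x) = ⊤
  WsTm (coh Γ U σ) = length σ ≡ length Γ × ScopedTy (length Γ) U × WsTy U × WsSub σ

  WsTy : Ty → Set
  WsTy ⋆ = ⊤
  WsTy (s ⟶[ A ] t) = WsTm s × WsTy A × WsTm t

  WsSub : Sub → Set
  WsSub [] = ⊤
  WsSub (t ∷ σ) = WsTm t × WsSub σ

ws-nth : ∀ σ j {t} → WsSub σ → nth σ j ≡ just t → WsTm t
ws-nth (u ∷ σ) zero (w , _) refl = w
ws-nth (u ∷ σ) (suc j) (_ , ws) eq = ws-nth σ j ws eq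

ws-lookup : ∀ σ j → WsSub σ → WsTm (lookupVar σ j)
ws-lookup σ j w with nth σ j in eq
... | just t = ws-nth σ j w eq
... | nothing = tt

ws-++ : ∀ xs ys → WsSub xs → WsSub ys → WsSub (xs ++ ys)
ws-++ [] ys _ w = w
ws-++ (x ∷ xs) ys (a , b) w = a , ws-++ xs ys b w

ws-take : ∀ n σ → WsSub σ → WsSub (take n σ)
ws-take zero σ w = tt
ws-take (suc n) [] w = tt
ws-take (suc n) (t ∷ σ) (a , b) = a , ws-take n σ b

ws-drop : ∀ n σ → WsSub σ → WsSub (drop n σ)
ws-drop zero σ w = w
ws-drop (suc n) [] w = tt
ws-drop (suc n) (t ∷ σ) (a , b) = ws-drop n σ b

ws-prune : ∀ σ α → WsSub σ → WsSub (pruneSub σ α)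
ws-prune σ α w = ws-++ (take (α ∸ 1) σ) (drop (suc α) σ) (ws-take (α ∸ 1) σ w) (ws-drop (suc α) σ w)

mutual
  ws-subst-tm : ∀ t σ → WsTm t → (∀ j → WsTm (lookupVar σ j)) → WsTm (t [ σ ]tm)
  ws-subst-tm (var x) σ w f = f x
  ws-subst-tm (coh Δ V τ) σ (l , sc , wV , wτ) f = trans (len-∘s τ σ) l , sc , wV , ws-subst-sub τ σ wτ f

  ws-subst-sub : ∀ τ σ → WsSub τ → (∀ j → WsTm (lookupVar σ j)) → WsSub (τ ∘s σ)
  ws-subst-sub [] σ w f = tt
  ws-subst-sub (t ∷ τ) σ (a , b) f = ws-subst-tm t σ a f , ws-subst-sub τ σ b f

ws-subst-ty : ∀ A σ → WsTy A → (∀ j → WsTm (lookupVar σ j)) → WsTy (A [ σ ]ty)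
ws-subst-ty ⋆ σ w f = tt
ws-subst-ty (s ⟶[ A ] t) σ (a , b , c) f = ws-subst-tm s σ a f , ws-subst-ty A σ b f , ws-subst-tm t σ c f

ws-full : ∀ T u → WsTy T → WsTm u → WsSub (full T u)
ws-full ⋆ u _ w = w , tt
ws-full (s ⟶[ A ] t) u (ws , wA , wt) w =
  ws-++ (full A s ∷ʳ t) [ u ] (ws-++ (full A s) [ t ] (ws-full A s wA ws) (wt , tt)) (w , tt)

ws-sphere : ∀ k → WsTy (sphere k)
ws-sphere zero = tt
ws-sphere (suc k) = tt , ws-sphere k , tt

scoped-sphere : ∀ k → ScopedTy (2 * k) (sphere k)
scoped-sphere (suc k) x (fv-base p) =
  ≤-trans (scoped-sphere k x p) (≤-trans (n≤1+n _) (≤-trans (n≤1+n _) (≤-reflexive (sym (two-suc k)))))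
scoped-sphere (suc k) x (fv-src fv-var) = ≤-trans (n≤1+n _) (≤-reflexive (sym (two-suc k)))
scoped-sphere (suc k) x (fv-tgt fv-var) = ≤-reflexive (sym (two-suc k))

scoped-idty : ∀ k → ScopedTy (length (disc k)) (idty k)
scoped-idty k rewrite disc-len k = λ
  { x (fv-base p) → ≤-trans (scoped-sphere k x p) (n≤1+n _)
  ; x (fv-src fv-var) → ≤-refl
  ; x (fv-tgt fv-var) → ≤-refl }

ws-iden : ∀ k τ → length τ ≡ suc (2 * k) → WsSub τ → WsTm (iden k [ τ ]tm)
ws-iden k τ e w = subst WsTm (sym (iden-eq k τ e))
  (trans e (sym (disc-len k)) , scoped-idty k , (tt , ws-sphere k , tt) , w)

scoped-arr : ∀ n s A t → ScopedTm n s → ScopedTy n A → ScopedTm n t → ScopedTy n (s ⟶[ A ] t)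
scoped-arr n s A t a b c x (fv-base p) = b x p
scoped-arr n s A t a b c x (fv-src p) = a x p
scoped-arr n s A t a b c x (fv-tgt p) = c x p

scoped-snoc : ∀ n σ t → ScopedSub n σ → ScopedTm n t → ScopedSub n (σ ∷ʳ t)
scoped-snoc n σ t a b x p with fv-++ σ [ t ] x p
... | inj₁ q = a x q
... | inj₂ (fv-hd q) = b x q

mutual
  ws-ty : ∀ {Γ A} → Γ ⊢ty A → WsTy A × ScopedTy (length Γ) A
  ws-ty (ty-⋆ p) = tt , λ x ()
  ws-ty {Γ} (ty-arr {A = A} {s} {t} pA ps pt) with ws-ty pA | ws-tm ps | ws-tm pt
  ... | wA , scA | ws , scs | wt , sct = (ws , wA , wt) , scoped-arr (length Γ) s A t scs scA sct

  ws-tm : ∀ {Γ t A} → Γ ⊢tm t ∶ A → WsTm t × ScopedTm (length Γ) t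
  ws-tm (tm-var {Γ} {x} p eq) = tt , λ { y fv-var → nth-just-< Γ x eq }
  ws-tm (tm-coh ps tyU sσ sc) with ws-ty tyU | ws-sub sσ
  ... | wU , scU | wσ , scσ , l = (l , scU , wU , wσ) , λ { x (fv-coh q) → scσ x q }
  ws-tm (tm-conv p _) = ws-tm p

  ws-sub : ∀ {Γ σ Δ} → Γ ⊢s σ ∶ Δ → WsSub σ × ScopedSub (length Γ) σ × length σ ≡ length Δ
  ws-sub (sub-nil p) = tt , (λ x ()) , refl
  ws-sub {Γ} (sub-ext {Δ = Δ} {σ} {A} {t} sσ tyA tt') with ws-sub sσ | ws-tm tt'
  ... | wσ , scσ , l | wt , sct = ws-++ σ [ t ] wσ (wt , tt) , scoped-snoc (length Γ) σ t scσ sct ,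
     trans (len-snoc σ t) (trans (cong suc l) (sym (len-snoc Δ A)))

ArrowEnds : Ctx → Tm → Ty → Tm → Set
ArrowEnds Γ s B t = Σ ℕ λ z → Σ ℕ λ y → s ≡ var z × t ≡ var y × nth Γ z ≡ just B × nth Γ y ≡ just B

record PsInv (Γ : Ctx) : Set where
  field
    scoped : ∀ i B → nth Γ i ≡ just B → ScopedTy i B
    arrows : ∀ i s B t → nth Γ i ≡ just (s ⟶[ B ] t) → ArrowEnds Γ s B t

introCtx : Ctx → ℕ → Ty → Ctx
introCtx Γ x A = (Γ ∷ʳ A) ∷ʳ (var x ⟶[ A ] var (length Γ))

data SnocView (Γ : Ctx) (A B : Ty) (i : ℕ) : Set where
  v-old : nth ((Γ ∷ʳ A) ∷ʳ B) i ≡ nth Γ i → SnocView Γ A B i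
  v-A : i ≡ length Γ → nth ((Γ ∷ʳ A) ∷ʳ B) i ≡ just A → SnocView Γ A B i
  v-B : i ≡ suc (length Γ) → nth ((Γ ∷ʳ A) ∷ʳ B) i ≡ just B → SnocView Γ A B i
  v-out : nth ((Γ ∷ʳ A) ∷ʳ B) i ≡ nothing → SnocView Γ A B i

snocView : ∀ Γ A B i → SnocView Γ A B i
snocView Γ A B i with <-cmp i (length Γ)
... | tri< p _ _ = v-old (trans (nth-snoc-in (Γ ∷ʳ A) B i (subst (i <_) (sym (len-snoc Γ A)) (≤-trans p (n≤1+n _))))
                                (nth-snoc-in Γ A i p))
... | tri≈ _ refl _ = v-A refl (trans (nth-snoc-in (Γ ∷ʳ A) B i (subst (i <_) (sym (len-snoc Γ A)) ≤-refl))
                                      (nth-snoc-len Γ A))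
... | tri> _ _ p with <-cmp i (suc (length Γ))
...   | tri< q _ _ = ⊥-elim (<⇒≱ q p)
...   | tri≈ _ refl _ = v-B refl (trans (cong (nth ((Γ ∷ʳ A) ∷ʳ B)) (sym (len-snoc Γ A))) (nth-snoc-len (Γ ∷ʳ A) B))
...   | tri> _ _ q = v-out (nth-out ((Γ ∷ʳ A) ∷ʳ B) i
                              (subst (_≤ i) (sym (trans (len-snoc (Γ ∷ʳ A) B) (cong suc (len-snoc Γ A)))) q))

snoc-persist : ∀ (Γ : Ctx) (A B : Ty) i {C : Ty} → nth Γ i ≡ just C → nth ((Γ ∷ʳ A) ∷ʳ B) i ≡ just C
snoc-persist Γ A B i e =
  trans (nth-snoc-in (Γ ∷ʳ A) B i (subst (i <_) (sym (len-snoc Γ A)) (≤-trans i<Γ (n≤1+n _))))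
        (trans (nth-snoc-in Γ A i i<Γ) e)
  where i<Γ = nth-just-< Γ i e

introCtx-top : ∀ Γ x A → nth (introCtx Γ x A) (suc (length Γ)) ≡ just (var x ⟶[ A ] var (length Γ))
introCtx-top Γ x A = trans (cong (nth (introCtx Γ x A)) (sym (len-snoc Γ A))) (nth-snoc-len (Γ ∷ʳ A) _)

introCtx-scoped : ∀ Γ x A → PsInv Γ → nth Γ x ≡ just A →
  ∀ i B → nth (introCtx Γ x A) i ≡ just B → ScopedTy i B
introCtx-scoped Γ x A inv ex i B e with snocView Γ A (var x ⟶[ A ] var (length Γ)) i
... | v-old q = PsInv.scoped inv i B (trans (sym q) e)
... | v-A refl q with trans (sym q) e
...   | refl = λ v p → <-trans (PsInv.scoped inv x A ex v p) (nth-just-< Γ x ex)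
introCtx-scoped Γ x A inv ex i B e | v-B refl q with trans (sym q) e
...   | refl = λ { v (fv-base p) → <-trans (PsInv.scoped inv x A ex v p) (<-trans (nth-just-< Γ x ex) (n<1+n _))
                 ; v (fv-src fv-var) → <-trans (nth-just-< Γ x ex) (n<1+n _)
                 ; v (fv-tgt fv-var) → n<1+n _ }
introCtx-scoped Γ x A inv ex i B e | v-out q with trans (sym q) e
...   | ()

arrowEnds-persist : ∀ Γ A C {s B t} → ArrowEnds Γ s B t → ArrowEnds ((Γ ∷ʳ A) ∷ʳ C) s B t
arrowEnds-persist Γ A C (z , y , p1 , p2 , p3 , p4) = z , y , p1 , p2 , snoc-persist Γ A C z p3 , snoc-persist Γ A C y p4

introCtx-arrows : ∀ Γ x A → PsInv Γ → nth Γ x ≡ just A →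
  ∀ i s B t → nth (introCtx Γ x A) i ≡ just (s ⟶[ B ] t) → ArrowEnds (introCtx Γ x A) s B t
introCtx-arrows Γ x A inv ex i s B t e with snocView Γ A (var x ⟶[ A ] var (length Γ)) i
... | v-old q = arrowEnds-persist Γ A _ (PsInv.arrows inv i s B t (trans (sym q) e))
... | v-A refl q = arrowEnds-persist Γ A _ (PsInv.arrows inv x s B t (trans ex (trans (sym q) e)))
... | v-B refl q with trans (sym q) e
...   | refl = x , length Γ , refl , refl , snoc-persist Γ A _ x ex ,
               trans (nth-snoc-in (Γ ∷ʳ A) _ (length Γ) (subst (length Γ <_) (sym (len-snoc Γ A)) ≤-refl))
                     (nth-snoc-len Γ A)
introCtx-arrows Γ x A inv ex i s B t e | v-out q with trans (sym q) e
...   | ()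

ps-invariant : ∀ {Γ x A} → Γ ⊢ps x ∶ A → PsInv Γ × nth Γ x ≡ just A
ps-invariant ps-base =
  record { scoped = λ { zero .⋆ refl x () ; (suc i) B () } ; arrows = λ { zero s B t () ; (suc i) s B t () } } , refl
ps-invariant (ps-intro {Γ} {x} {A} d) with ps-invariant d
... | inv , ex = record { scoped = introCtx-scoped Γ x A inv ex ; arrows = introCtx-arrows Γ x A inv ex } ,
                 introCtx-top Γ x A
ps-invariant (ps-descent {f = f} {s} {A} {y} d) with ps-invariant d
... | inv , ex with PsInv.arrows inv f s A (var y) ex
...   | _ , _ , _ , refl , _ , ey = inv , ey

ps-types-ws : ∀ {Γ} → PsInv Γ → ∀ i B → nth Γ i ≡ just B → WsTy B
ps-types-ws {Γ} inv = <-rec (λ i → ∀ B → nth Γ i ≡ just B → WsTy B) go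
  where
    go : ∀ i → (∀ {j} → j < i → ∀ B → nth Γ j ≡ just B → WsTy B) → ∀ B → nth Γ i ≡ just B → WsTy B
    go i ih ⋆ e = tt
    go i ih (s ⟶[ C ] t) e with PsInv.arrows inv i s C t e
    ... | z , y , refl , refl , ez , _ = tt , ih (PsInv.scoped inv i _ e z (fv-src fv-var)) C ez , tt

record LocMaxShape (Γ : Ctx) (α : ℕ) : Set where
  field
    a : ℕ
    α≡ : α ≡ suc a
    z : ℕ
    A : Ty
    type-α : nth Γ (suc a) ≡ just (var z ⟶[ A ] var a)
    z<a : z < a
    inv : PsInv Γ

locMaxIn-shape : ∀ {Γ x A} {d : Γ ⊢ps x ∶ A} {α} → LocMaxIn d α →
  Σ ℕ λ a → α ≡ suc a × Σ ℕ λ z → Σ Ty λ B → nth Γ (suc a) ≡ just (var z ⟶[ B ] var a) × z < a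
locMaxIn-shape (lm-here {Γ} {x} {A} d) = length Γ , refl , x , A , introCtx-top Γ x A , nth-just-< Γ x (proj₂ (ps-invariant d))
locMaxIn-shape (lm-intro {Γ} {x} {A} l) with locMaxIn-shape l
... | a , refl , z , B , e , lt = a , refl , z , B , snoc-persist Γ A _ (suc a) e , lt
locMaxIn-shape (lm-descent l) = locMaxIn-shape l

locMaxShape : ∀ Γ α → LocMax Γ α → LocMaxShape Γ α
locMaxShape Γ α (x , d , lm) with locMaxIn-shape lm
... | a , eq , z , A , e , lt = record { a = a ; α≡ = eq ; z = z ; A = A ; type-α = e ; z<a = lt ; inv = proj₁ (ps-invariant d) }

<ᵇ-true : ∀ j k → j < k → (j <ᵇ k) ≡ true
<ᵇ-true zero (suc k) _ = refl
<ᵇ-true (suc j) (suc k) (s≤s p) = <ᵇ-true j k p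

<ᵇ-false : ∀ j k → k ≤ j → (j <ᵇ k) ≡ false
<ᵇ-false j zero _ = refl
<ᵇ-false (suc j) (suc k) (s≤s p) = <ᵇ-false j k p

≡ᵇ-true : ∀ j → (j ≡ᵇ j) ≡ true
≡ᵇ-true zero = refl
≡ᵇ-true (suc j) = ≡ᵇ-true j

≡ᵇ-false : ∀ j k → j ≢ k → (j ≡ᵇ k) ≡ false
≡ᵇ-false zero zero p = ⊥-elim (p refl)
≡ᵇ-false zero (suc k) p = refl
≡ᵇ-false (suc j) zero p = refl
≡ᵇ-false (suc j) (suc k) p = ≡ᵇ-false j k λ e → p (cong suc e)

module Pruning (Γ : Ctx) (a z : ℕ) (A : Ty)
  (type-α : nth Γ (suc a) ≡ just (var z ⟶[ A ] var a)) (z<a : z < a) (inv : PsInv Γ) where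

  L : ℕ
  L = length Γ

  α<L : suc a < L
  α<L = nth-just-< Γ (suc a) type-α

  type-z : nth Γ z ≡ just A
  type-z with PsInv.arrows inv (suc a) (var z) A (var a) type-α
  ... | _ , _ , refl , refl , p , _ = p

  type-a : nth Γ a ≡ just A
  type-a with PsInv.arrows inv (suc a) (var z) A (var a) type-α
  ... | _ , _ , refl , refl , _ , q = q

  scoped-A : ScopedTy z A
  scoped-A = PsInv.scoped inv z A type-z

  π : Sub
  π = πsub Γ (suc a)

  Γ' : Ctx
  Γ' = pruneCtx Γ (suc a)

  idz : Tm
  idz = iden (dim+1 A) [ full A (var z) ]tm

  length-full : length (full A (var z)) ≡ suc (2 * dim+1 A)
  length-full = full-len A (var z)

  π-entry : ℕ → Tm
  π-entry j = if j <ᵇ a then var j else if j ≡ᵇ a then var z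
              else if j ≡ᵇ suc a then idz else var (j ∸ 2)

  π-tab : π ≡ tab L π-entry
  π-tab rewrite type-α = refl

  π-entry-below : ∀ j → j < a → π-entry j ≡ var j
  π-entry-below j p rewrite <ᵇ-true j a p = refl

  π-entry-target : π-entry a ≡ var z
  π-entry-target rewrite <ᵇ-false a a ≤-refl | ≡ᵇ-true a = refl

  π-entry-α : π-entry (suc a) ≡ idz
  π-entry-α rewrite <ᵇ-false (suc a) a (n≤1+n a) | ≡ᵇ-false (suc a) a 1+n≢n | ≡ᵇ-true a = refl

  π-entry-above : ∀ j → suc a < j → π-entry j ≡ var (j ∸ 2)
  π-entry-above j α<j rewrite <ᵇ-false j a (<⇒≤ (<-trans (n<1+n a) α<j))
                            | ≡ᵇ-false j a (λ e → <-irrefl (sym e) (<-trans (n<1+n a) α<j))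
                            | ≡ᵇ-false j (suc a) (λ e → <-irrefl (sym e) α<j) = refl

  π-in : ∀ j → j < L → lookupVar π j ≡ π-entry j
  π-in j p rewrite π-tab = lookup-tab-in L π-entry j p

  π-out : ∀ j → L ≤ j → lookupVar π j ≡ var j
  π-out j p rewrite π-tab = lookup-tab-out L π-entry j p

  data Class (j : ℕ) : Set where
    c-below : j < a → lookupVar π j ≡ var j → Class j
    c-target : j ≡ a → lookupVar π j ≡ var z → Class j
    c-α : j ≡ suc a → lookupVar π j ≡ idz → Class j
    c-above : (i : ℕ) → j ≡ suc (suc a) + i → j < L → lookupVar π j ≡ var (a + i) → Class j
    c-out : L ≤ j → lookupVar π j ≡ var j → Class j

  class : ∀ j → Class j
  class j with <-cmp j a
  ... | tri< p _ _ = c-below p (trans (π-in j (<-trans p (<-trans (n<1+n a) α<L))) (π-entry-below j p))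
  ... | tri≈ _ refl _ = c-target refl (trans (π-in j (<-trans (n<1+n a) α<L)) π-entry-target)
  ... | tri> _ _ p with <-cmp j (suc a)
  ...   | tri< q _ _ = ⊥-elim (<⇒≱ q p)
  ...   | tri≈ _ refl _ = c-α refl (trans (π-in j α<L) π-entry-α)
  ...   | tri> _ _ q with j <? L
  ...     | yes r = c-above i j≡ r (trans (π-in j r) (trans (π-entry-above j q) (cong (λ k → var (k ∸ 2)) j≡)))
    where
      i = j ∸ suc (suc a)
      j≡ : j ≡ suc (suc a) + i
      j≡ = sym (m+[n∸m]≡n q)
  ...     | no r = c-out (≮⇒≥ r) (π-out j (≮⇒≥ r))

  π-below : ∀ x → x < a → lookupVar π x ≡ var x
  π-below x p = trans (π-in x (<-trans p (<-trans (n<1+n a) α<L))) (π-entry-below x p)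

  fv-π : ∀ j v → j < L → FVtm v (lookupVar π j) → v < a ⊎ suc (suc v) ≡ j
  fv-π j v j<L p with class j
  ... | c-below q e with subst (FVtm v) e p
  ...   | fv-var = inj₁ q
  fv-π j v j<L p | c-target q e with subst (FVtm v) e p
  ...   | fv-var = inj₁ z<a
  fv-π j v j<L p | c-α q e with fv-full A (var z) v (fv-iden (dim+1 A) (full A (var z)) v length-full (subst (FVtm v) e p))
  ...   | inj₁ r = inj₁ (<-trans (scoped-A v r) z<a)
  ...   | inj₂ fv-var = inj₁ z<a
  fv-π j v j<L p | c-above i refl _ e with subst (FVtm v) e p
  ...   | fv-var = inj₂ refl
  fv-π j v j<L p | c-out q _ = ⊥-elim (<⇒≱ j<L q)

  -- π renumbers variables above α down by two
  scoped-π : ∀ m U → a ≤ m → suc (suc m) ≤ L → ScopedTy (suc (suc m)) U → ScopedTy m (U [ π ]ty)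
  scoped-π m U a≤m m+2≤L sc v p with fv-subst-ty U π v p
  ... | j , q , r with fv-π j v (<-≤-trans (sc j q) m+2≤L) r
  ...   | inj₁ v<a = <-≤-trans v<a a≤m
  ...   | inj₂ e = s≤s⁻¹ (s≤s⁻¹ (subst (_< suc (suc m)) (sym e) (sc j q)))

  ws-π : ∀ j → WsTm (lookupVar π j)
  ws-π j with class j
  ... | c-below _ e = subst WsTm (sym e) tt
  ... | c-target _ e = subst WsTm (sym e) tt
  ... | c-α _ e = subst WsTm (sym e)
          (ws-iden (dim+1 A) (full A (var z)) length-full (ws-full A (var z) (ps-types-ws inv z A type-z) tt))
  ... | c-above _ _ _ e = subst WsTm (sym e) tt
  ... | c-out _ e = subst WsTm (sym e) tt

  length-Γ' : length Γ' ≡ L ∸ 2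
  length-Γ' = length-cut a Γ _ α<L (length-map _ (drop (suc (suc a)) Γ))

  length-pruneSub : ∀ σ → length σ ≡ L → length (pruneSub σ (suc a)) ≡ L ∸ 2
  length-pruneSub σ e = trans (length-cut a σ _ (subst (suc a <_) (sym e) α<L) refl) (cong (_∸ 2) e)

  Γ'-shorter : length Γ' < L
  Γ'-shorter = subst (_< L) (sym length-Γ') (∸-monoʳ-< {L} {2} {0} z<s (≤-trans (s≤s (s≤s z≤n)) α<L))

  scoped-Γ' : ∀ U → ScopedTy L U → ScopedTy (length Γ') (U [ π ]ty)
  scoped-Γ' U sc = subst (λ n → ScopedTy n (U [ π ]ty)) (sym length-Γ')
    (scoped-π (L ∸ 2) U a≤L-2 (≤-reflexive L-2+2) (subst (λ n → ScopedTy n U) (sym L-2+2) sc))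
    where
      L-2+2 : suc (suc (L ∸ 2)) ≡ L
      L-2+2 = m+[n∸m]≡n {2} (≤-trans (s≤s (s≤s z≤n)) α<L)
      a≤L-2 : a ≤ L ∸ 2
      a≤L-2 = ≤-trans (≤-reflexive (sym (m+n∸m≡n 2 a))) (∸-monoˡ-≤ 2 α<L)

  take-a : length (take a Γ) ≡ a
  take-a = trans (length-take a Γ) (m≤n⇒m⊓n≡m (<⇒≤ (<-trans (n<1+n a) α<L)))

  nth-Γ'-below : ∀ j → j < a → nth Γ' j ≡ nth Γ j
  nth-Γ'-below j p = trans (nth-++ˡ (take a Γ) _ j (subst (j <_) (sym take-a) p)) (nth-take Γ a j p)

  nth-Γ'-above : ∀ i → nth Γ' (a + i) ≡ Maybe.map (_[ π ]ty) (nth Γ (suc (suc a) + i))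
  nth-Γ'-above i = begin
      nth Γ' (a + i)                                                  ≡⟨ cong (λ k → nth Γ' (k + i)) (sym take-a) ⟩
      nth Γ' (length (take a Γ) + i)                                  ≡⟨ nth-++ʳ (take a Γ) _ i ⟩
      nth (map (_[ π ]ty) (drop (suc (suc a)) Γ)) i                   ≡⟨ nth-map _ (drop (suc (suc a)) Γ) i ⟩
      Maybe.map (_[ π ]ty) (nth (drop (suc (suc a)) Γ) i)             ≡⟨ cong (Maybe.map _) (nth-drop Γ (suc (suc a)) i) ⟩
      Maybe.map (_[ π ]ty) (nth Γ (suc (suc a) + i))                  ∎
    where open ≡-Reasoning

  -- The canonical valuation of Γ dominates that of Γ' pushed through π:
  -- by strong induction on j, since the type of a variable only mentions
  -- earlier variables.
  π-dominated : ∀ j → wTm (lookupVar π j) (ctxVal Γ') ≤ ctxVal Γ j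
  π-dominated = <-rec _ step
    where
      ν ν' : ℕ → ℕ
      ν = ctxVal Γ
      ν' = ctxVal Γ'

      type-of : ∀ j → j < L → Σ Ty λ B → nth Γ j ≡ just B
      type-of j = nth-in Γ j

      scoped : ∀ j B → nth Γ j ≡ just B → ScopedTy j B
      scoped = PsInv.scoped inv

      step : ∀ j → (∀ {i} → i < j → wTm (lookupVar π i) ν' ≤ ν i) → wTm (lookupVar π j) ν' ≤ ν j
      step j ih with class j
      -- below a, variables keep their types
      ... | c-below p e with type-of j (<-trans p (<-trans (n<1+n a) α<L))
      ...   | B , eB = begin
          wTm (lookupVar π j) ν'   ≡⟨ cong (λ t → wTm t ν') e ⟩
          ν' j                     ≡⟨ ctxVal-var Γ' j B (trans (nth-Γ'-below j p) eB) (scoped j B eB) ⟩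
          suc (wTy B ν')           ≤⟨ s≤s (mono-ty B below) ⟩
          suc (wTy B ν)            ≡⟨ sym (ctxVal-var Γ j B eB (scoped j B eB)) ⟩
          ν j                      ∎
        where
          open ≤-Reasoning
          below : ∀ x → FVty x B → ν' x ≤ ν x
          below x q = subst (_≤ ν x) (cong (λ t → wTm t ν') (π-below x (<-trans (scoped j B eB x q) p)))
                            (ih (scoped j B eB x q))
      -- the target a of α becomes its source z, of the same type A
      step j ih | c-target refl e = begin
          wTm (lookupVar π a) ν'   ≡⟨ cong (λ t → wTm t ν') e ⟩
          ν' z                     ≡⟨ cong (λ t → wTm t ν') (sym (π-below z z<a)) ⟩
          wTm (lookupVar π z) ν'   ≤⟨ ih z<a ⟩
          ν z                      ≡⟨ ctxVal-var Γ z A type-z scoped-A ⟩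
          suc (wTy A ν)            ≡⟨ sym (ctxVal-var Γ a A type-a (λ x q → <-trans (scoped-A x q) z<a)) ⟩
          ν a                      ∎
        where open ≤-Reasoning
      -- α becomes the identity on z, whose weight is that of z plus that of A
      step j ih | c-α refl e = begin
          wTm (lookupVar π (suc a)) ν'         ≡⟨ cong (λ t → wTm t ν') e ⟩
          wTm idz ν'                           ≡⟨ wTm-iden (dim+1 A) (full A (var z)) ν' length-full ⟩
          suc (wSub (full A (var z)) ν')       ≡⟨ cong suc (wSub-full A (var z) ν') ⟩
          suc (wTy A ν' + ν' z)                ≤⟨ s≤s (+-mono-≤ (mono-ty A λ x q → νz≤ x (<-trans (scoped-A x q) z<a)) (νz≤ z z<a)) ⟩
          suc (wTy A ν + ν z)                  ≤⟨ s≤s (≤-trans (≤-reflexive (+-comm (wTy A ν) (ν z))) (m≤m+n _ (ν a))) ⟩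
          suc (ν z + wTy A ν + ν a)            ≡⟨ sym (ctxVal-var Γ (suc a) _ type-α (scoped (suc a) _ type-α)) ⟩
          ν (suc a)                            ∎
        where
          open ≤-Reasoning
          νz≤ : ∀ x → x < a → ν' x ≤ ν x
          νz≤ x p = subst (_≤ ν x) (cong (λ t → wTm t ν') (π-below x p)) (ih (<-trans p (n<1+n a)))
      -- above α, variables are renumbered and their types transported along π
      step j ih | c-above i refl j<L e with type-of j j<L
      ...   | B , eB = begin
          wTm (lookupVar π j) ν'   ≡⟨ cong (λ t → wTm t ν') e ⟩
          ν' (a + i)               ≡⟨ ctxVal-var Γ' (a + i) (B [ π ]ty) (trans (nth-Γ'-above i) (cong (Maybe.map _) eB))
                                        (scoped-π (a + i) B (m≤m+n a i) (<⇒≤ j<L) (scoped j B eB)) ⟩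
          suc (wTy (B [ π ]ty) ν') ≡⟨ cong suc (wTy-subst B π ν') ⟩
          suc (wTy B (pushVal π ν')) ≤⟨ s≤s (mono-ty B λ x q → ih (scoped j B eB x q)) ⟩
          suc (wTy B ν)            ≡⟨ sym (ctxVal-var Γ j B eB (scoped j B eB)) ⟩
          ν j                      ∎
        where open ≤-Reasoning
      step j ih | c-out p e = begin
          wTm (lookupVar π j) ν'   ≡⟨ cong (λ t → wTm t ν') e ⟩
          ν' j                     ≡⟨ ctxVal-out Γ' j (≤-trans (<⇒≤ Γ'-shorter) p) ⟩
          1                        ≤⟨ valOf-pos (ctxWeights [] Γ) j ⟩
          ν j                      ∎
        where open ≤-Reasoning

length-reduct-sub : ∀ σ σ' → σ ⇝s σ' → length σ' ≡ length σ
length-reduct-sub (t ∷ σ) .(_ ∷ σ) (inj₁ (t' , r , refl)) = refl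
length-reduct-sub (t ∷ σ) .(t ∷ _) (inj₂ (_ , σ' , r , refl)) = cong suc (length-reduct-sub σ σ' r)

length-endo : ∀ T u σ → length (full T u ∘s σ) ≡ suc (2 * dim+1 T)
length-endo T u σ = trans (len-∘s (full T u) σ) (full-len T u)

scoped-endo : ∀ (Γ : Ctx) (σ : Sub) T u → length σ ≡ length Γ → ScopedTy (length Γ) (u ⟶[ T ] u) →
  ScopedSub (length σ) (full T u)
scoped-endo Γ σ T u l sc = scoped-full (length σ) T u (λ v q → subst (v <_) (sym l) (sc v (fv-base q)))
                                                    (λ v q → subst (v <_) (sym l) (sc v (fv-src q)))

mutual
  fv-reduct-tm : ∀ t t' → WsTm t → t ⇝tm t' → ∀ x → FVtm x t' → FVtm x t
  fv-reduct-tm (coh Γ U σ) _ (_ , _ , _ , wσ) (inj₁ (σ' , r , refl)) x (fv-coh q) = fv-coh (fv-reduct-sub σ σ' wσ r x q)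
  fv-reduct-tm (coh Γ U σ) _ w (inj₂ (inj₁ (_ , α , _ , refl))) x (fv-coh q) = fv-coh (fv-prune σ α x q)
  fv-reduct-tm (coh Γ U σ) _ w (inj₂ (inj₂ (inj₁ (_ , _ , U' , r , refl)))) x (fv-coh q) = fv-coh q
  fv-reduct-tm (coh Γ U σ) t' w (inj₂ (inj₂ (inj₂ (inj₁ (_ , _ , _ , _ , e))))) x p with last-nth σ e
  ... | j , e' = fv-coh (fv-nth σ j x e' p)
  fv-reduct-tm (coh Γ .(u ⟶[ T ] u) σ) _ (l , sc , _ , _)
      (inj₂ (inj₂ (inj₂ (inj₂ (_ , _ , _ , _ , _ , u , T , refl , refl))))) x p =
    fv-coh (fv-subst-scoped (full T u) σ x (scoped-endo Γ σ T u l sc) (fv-iden (dim+1 T) (full T u ∘s σ) x (length-endo T u σ) p))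

  fv-reduct-sub : ∀ σ σ' → WsSub σ → σ ⇝s σ' → ∀ x → FVsub x σ' → FVsub x σ
  fv-reduct-sub (t ∷ σ) _ (wt , _) (inj₁ (t' , r , refl)) x (fv-hd q) = fv-hd (fv-reduct-tm t t' wt r x q)
  fv-reduct-sub (t ∷ σ) _ _ (inj₁ (t' , r , refl)) x (fv-tl q) = fv-tl q
  fv-reduct-sub (t ∷ σ) _ _ (inj₂ (_ , σ' , r , refl)) x (fv-hd q) = fv-hd q
  fv-reduct-sub (t ∷ σ) _ (_ , wσ) (inj₂ (_ , σ' , r , refl)) x (fv-tl q) = fv-tl (fv-reduct-sub σ σ' wσ r x q)

  fv-reduct-ty : ∀ A A' → WsTy A → A ⇝ty A' → ∀ x → FVty x A' → FVty x A
  fv-reduct-ty (u ⟶[ T ] v) _ (_ , wT , _) (inj₁ (T' , r , refl)) x (fv-base q) = fv-base (fv-reduct-ty T T' wT r x q)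
  fv-reduct-ty (u ⟶[ T ] v) _ _ (inj₁ (T' , r , refl)) x (fv-src q) = fv-src q
  fv-reduct-ty (u ⟶[ T ] v) _ _ (inj₁ (T' , r , refl)) x (fv-tgt q) = fv-tgt q
  fv-reduct-ty (u ⟶[ T ] v) _ _ (inj₂ (inj₁ (_ , u' , r , refl))) x (fv-base q) = fv-base q
  fv-reduct-ty (u ⟶[ T ] v) _ (wu , _ , _) (inj₂ (inj₁ (_ , u' , r , refl))) x (fv-src q) = fv-src (fv-reduct-tm u u' wu r x q)
  fv-reduct-ty (u ⟶[ T ] v) _ _ (inj₂ (inj₁ (_ , u' , r , refl))) x (fv-tgt q) = fv-tgt q
  fv-reduct-ty (u ⟶[ T ] v) _ _ (inj₂ (inj₂ (_ , _ , v' , r , refl))) x (fv-base q) = fv-base q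
  fv-reduct-ty (u ⟶[ T ] v) _ _ (inj₂ (inj₂ (_ , _ , v' , r , refl))) x (fv-src q) = fv-src q
  fv-reduct-ty (u ⟶[ T ] v) _ (_ , _ , wv) (inj₂ (inj₂ (_ , _ , v' , r , refl))) x (fv-tgt q) = fv-tgt (fv-reduct-tm v v' wv r x q)

ws-prune-coh : ∀ Γ U σ α → LocMax Γ α → WsTm (coh Γ U σ) →
  WsTm (coh (pruneCtx Γ α) (U [ πsub Γ α ]ty) (pruneSub σ α))
ws-prune-coh Γ U σ α lm (l , sc , wU , wσ) with locMaxShape Γ α lm
... | record { a = a ; α≡ = refl ; z = z ; A = A ; type-α = tα ; z<a = z<a ; inv = inv } =
  trans (P.length-pruneSub σ l) (sym P.length-Γ') , P.scoped-Γ' U sc , ws-subst-ty U P.π wU P.ws-π , ws-prune σ (suc a) wσ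
  where module P = Pruning Γ a z A tα z<a inv

mutual
  ws-reduct-tm : ∀ t t' → WsTm t → t ⇝tm t' → WsTm t'
  ws-reduct-tm (coh Γ U σ) _ (l , sc , wU , wσ) (inj₁ (σ' , r , refl)) =
    trans (length-reduct-sub σ σ' r) l , sc , wU , ws-reduct-sub σ σ' wσ r
  ws-reduct-tm (coh Γ U σ) _ w (inj₂ (inj₁ (_ , α , (_ , lm , _) , refl))) = ws-prune-coh Γ U σ α lm w
  ws-reduct-tm (coh Γ U σ) _ (l , sc , wU , wσ) (inj₂ (inj₂ (inj₁ (_ , _ , U' , r , refl)))) =
    l , (λ v q → sc v (fv-reduct-ty U U' wU r v q)) , ws-reduct-ty U U' wU r , wσ
  ws-reduct-tm (coh Γ U σ) t' (_ , _ , _ , wσ) (inj₂ (inj₂ (inj₂ (inj₁ (_ , _ , _ , _ , e))))) with last-nth σ e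
  ... | j , e' = ws-nth σ j wσ e'
  ws-reduct-tm (coh Γ .(u ⟶[ T ] u) σ) _ (_ , _ , (wu , wT , _) , wσ)
      (inj₂ (inj₂ (inj₂ (inj₂ (_ , _ , _ , _ , _ , u , T , refl , refl))))) =
    ws-iden (dim+1 T) (full T u ∘s σ) (length-endo T u σ)
      (ws-subst-sub (full T u) σ (ws-full T u wT wu) (λ j → ws-lookup σ j wσ))

  ws-reduct-sub : ∀ σ σ' → WsSub σ → σ ⇝s σ' → WsSub σ'
  ws-reduct-sub (t ∷ σ) _ (wt , wσ) (inj₁ (t' , r , refl)) = ws-reduct-tm t t' wt r , wσ
  ws-reduct-sub (t ∷ σ) _ (wt , wσ) (inj₂ (_ , σ' , r , refl)) = wt , ws-reduct-sub σ σ' wσ r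

  ws-reduct-ty : ∀ A A' → WsTy A → A ⇝ty A' → WsTy A'
  ws-reduct-ty (u ⟶[ T ] v) _ (wu , wT , wv) (inj₁ (T' , r , refl)) = wu , ws-reduct-ty T T' wT r , wv
  ws-reduct-ty (u ⟶[ T ] v) _ (wu , wT , wv) (inj₂ (inj₁ (_ , u' , r , refl))) = ws-reduct-tm u u' wu r , wT , wv
  ws-reduct-ty (u ⟶[ T ] v) _ (wu , wT , wv) (inj₂ (inj₂ (_ , _ , v' , r , refl))) = wu , wT , ws-reduct-tm v v' wv r

cohWeight-strict-ty : ∀ Γ U U' → wTy U' (ctxVal Γ) < wTy U (ctxVal Γ) → cohWeight Γ U' < cohWeight Γ U
cohWeight-strict-ty Γ U U' lt = *-monoˡ-< (suc (length Γ)) (s≤s (s≤s lt))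

cohWeight-strict-ctx : ∀ Γ U Γ' U' → wTy U' (ctxVal Γ') ≤ wTy U (ctxVal Γ) → length Γ' < length Γ →
  cohWeight Γ' U' < cohWeight Γ U
cohWeight-strict-ctx Γ U Γ' U' le lt =
  ≤-<-trans (*-monoˡ-≤ (suc (length Γ')) (s≤s (s≤s le))) (*-monoʳ-< (2 + wTy U (ctxVal Γ)) (s≤s lt))

not-IdForm : ∀ Γ U σ → ¬ IsIdentity (coh Γ U σ) → ¬ IdForm Γ U (length σ)
not-IdForm Γ U σ notId f = notId (IdForm→IsIdentity Γ U σ f)

pushVal-bound : ∀ σ ρ x → x < length σ → pushVal σ ρ x ≤ wSub σ ρ
pushVal-bound σ ρ x p with nth-in σ x p
... | t , e = subst (_≤ wSub σ ρ) (cong (λ t → wTm t ρ) (sym (lookup-just σ x e))) (wSub-nth σ x ρ e)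

prune-decreases : ∀ Γ U σ α ρ → ¬ IsIdentity (coh Γ U σ) → LocMax Γ α →
  wTm (coh (pruneCtx Γ α) (U [ πsub Γ α ]ty) (pruneSub σ α)) ρ < wTm (coh Γ U σ) ρ
prune-decreases Γ U σ α ρ notId lm with locMaxShape Γ α lm
... | record { a = a ; α≡ = refl ; z = z ; A = A ; type-α = tα ; z<a = z<a ; inv = inv } = begin-strict
    cohFactor Γ' U' (length σ') * suc (wSub σ' ρ)  ≤⟨ *-mono-≤ (cohFactor-≤ Γ' U' _) (s≤s (wSub-prune σ (suc a) ρ)) ⟩
    cohWeight Γ' U' * suc (wSub σ ρ)               <⟨ *-monoˡ-< (suc (wSub σ ρ)) (cohWeight-strict-ctx Γ U Γ' U' U'≤U P.Γ'-shorter) ⟩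
    cohWeight Γ U * suc (wSub σ ρ)                 ≡⟨ cong (_* suc (wSub σ ρ)) (sym (cohFactor-nonId Γ U _ (not-IdForm Γ U σ notId))) ⟩
    cohFactor Γ U (length σ) * suc (wSub σ ρ)      ∎
  where
    open ≤-Reasoning
    module P = Pruning Γ a z A tα z<a inv
    Γ' = pruneCtx Γ (suc a)
    U' = U [ P.π ]ty
    σ' = pruneSub σ (suc a)
    U'≤U : wTy U' (ctxVal Γ') ≤ wTy U (ctxVal Γ)
    U'≤U = ≤-trans (≤-reflexive (wTy-subst U P.π (ctxVal Γ'))) (mono-ty U λ x _ → P.π-dominated x)

type-step-decreases : ∀ Γ U U' σ ρ → (∀ ρ' → wTy U' ρ' < wTy U ρ') → U ⇝ty U' →
  wTm (coh Γ U' σ) ρ < wTm (coh Γ U σ) ρ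
type-step-decreases Γ U U' σ ρ dec r = begin-strict
    cohFactor Γ U' n * suc S  ≤⟨ *-monoˡ-≤ (suc S) (cohFactor-≤ Γ U' n) ⟩
    cohWeight Γ U' * suc S    <⟨ *-monoˡ-< (suc S) (cohWeight-strict-ty Γ U U' (dec (ctxVal Γ))) ⟩
    cohWeight Γ U * suc S     ≡⟨ cong (_* suc S) (sym (cohFactor-nonId Γ U n identity-normal)) ⟩
    cohFactor Γ U n * suc S   ∎
  where
    open ≤-Reasoning
    n = length σ
    S = wSub σ ρ
    -- identity types do not reduce
    identity-normal : ¬ IdForm Γ U n
    identity-normal (k , _ , refl , _) = idty-irreducible k U' r

disc-decreases : ∀ Γ U σ t ρ → last σ ≡ just t → wTm t ρ < wTm (coh Γ U σ) ρ
disc-decreases Γ U σ t ρ e with last-nth σ e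
... | j , e' = <-≤-trans (s≤s (wSub-nth σ j ρ e'))
                 (m≤n*m (suc (wSub σ ρ)) (cohFactor Γ U (length σ)) ⦃ >-nonZero (cohFactor-pos Γ U (length σ)) ⦄)

-- (E): the identity weighs about |{T,u}| times σ, and |{T,u}| ≤ |U|
endo-decreases : ∀ Γ T u σ ρ → length σ ≡ length Γ → ScopedTy (length Γ) (u ⟶[ T ] u) →
  ¬ IsIdentity (coh Γ (u ⟶[ T ] u) σ) →
  wTm (iden (dim+1 T) [ full T u ∘s σ ]tm) ρ < wTm (coh Γ (u ⟶[ T ] u) σ) ρ
endo-decreases Γ T u σ ρ l sc notId = begin-strict
    wTm (iden (dim+1 T) [ full T u ∘s σ ]tm) ρ  ≡⟨ wTm-iden (dim+1 T) (full T u ∘s σ) ρ (length-endo T u σ) ⟩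
    suc (wSub (full T u ∘s σ) ρ)                ≡⟨ cong suc (wSub-subst (full T u) σ ρ) ⟩
    suc (wSub (full T u) (pushVal σ ρ))         ≤⟨ s≤s (bound-sub (full T u) (pushVal σ ρ) S entries≤) ⟩
    suc (c * suc S)                             ≤⟨ s≤s (*-monoˡ-≤ (suc S) c≤m) ⟩
    suc (m * suc S)                             <⟨ s≤s (≤-trans (s≤s (m≤n+m _ S)) (m≤n+m _ S)) ⟩
    (2 + m) * suc S                             ≤⟨ *-monoˡ-≤ (suc S) (m≤m*n (2 + m) (suc (length Γ))) ⟩
    cohWeight Γ U * suc S                       ≡⟨ cong (_* suc S) (sym (cohFactor-nonId Γ U _ (not-IdForm Γ U σ notId))) ⟩
    cohFactor Γ U (length σ) * suc S            ∎
  where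
    open ≤-Reasoning
    U = u ⟶[ T ] u
    S = wSub σ ρ
    c = wSub (full T u) ones
    m = wTy U (ctxVal Γ)
    entries≤ : ∀ x → FVsub x (full T u) → pushVal σ ρ x ≤ suc S
    entries≤ x q = ≤-trans (pushVal-bound σ ρ x (scoped-endo Γ σ T u l sc x q)) (n≤1+n S)
    c≤m : c ≤ m
    c≤m = begin
      wSub (full T u) ones                   ≡⟨ wSub-full T u ones ⟩
      wTy T ones + wTm u ones                ≡⟨ +-comm (wTy T ones) (wTm u ones) ⟩
      wTm u ones + wTy T ones                ≤⟨ m≤m+n _ (wTm u ones) ⟩
      wTy U ones                             ≤⟨ mono-ty U (λ i _ → valOf-pos (ctxWeights [] Γ) i) ⟩
      m                                      ∎

mutual
  decrease-tm : ∀ t t' → WsTm t → t ⇝tm t' → ∀ ρ → wTm t' ρ < wTm t ρ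
  decrease-tm (coh Γ U σ) _ (_ , _ , _ , wσ) (inj₁ (σ' , r , refl)) ρ =
    subst (λ n → cohFactor Γ U n * suc (wSub σ' ρ) < h * suc (wSub σ ρ)) (sym (length-reduct-sub σ σ' r))
      (*-monoʳ-< h ⦃ >-nonZero (cohFactor-pos Γ U (length σ)) ⦄ (s≤s (decrease-sub σ σ' wσ r ρ)))
    where h = cohFactor Γ U (length σ)
  decrease-tm (coh Γ U σ) _ _ (inj₂ (inj₁ (_ , α , (notId , lm , _) , refl))) ρ =
    prune-decreases Γ U σ α ρ notId lm
  decrease-tm (coh Γ U σ) _ (_ , _ , wU , _) (inj₂ (inj₂ (inj₁ (_ , _ , U' , r , refl)))) ρ =
    type-step-decreases Γ U U' σ ρ (decrease-ty U U' wU r) r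
  decrease-tm (coh Γ U σ) t' _ (inj₂ (inj₂ (inj₂ (inj₁ (_ , _ , _ , _ , e))))) ρ =
    disc-decreases Γ U σ t' ρ e
  decrease-tm (coh Γ .(u ⟶[ T ] u) σ) _ (l , sc , _ , _)
      (inj₂ (inj₂ (inj₂ (inj₂ (_ , _ , _ , _ , notId , u , T , refl , refl))))) ρ =
    endo-decreases Γ T u σ ρ l sc notId

  decrease-sub : ∀ σ σ' → WsSub σ → σ ⇝s σ' → ∀ ρ → wSub σ' ρ < wSub σ ρ
  decrease-sub (t ∷ σ) _ (wt , _) (inj₁ (t' , r , refl)) ρ = +-monoˡ-< (wSub σ ρ) (decrease-tm t t' wt r ρ)
  decrease-sub (t ∷ σ) _ (_ , wσ) (inj₂ (_ , σ' , r , refl)) ρ = +-monoʳ-< (wTm t ρ) (decrease-sub σ σ' wσ r ρ)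

  decrease-ty : ∀ A A' → WsTy A → A ⇝ty A' → ∀ ρ → wTy A' ρ < wTy A ρ
  decrease-ty (u ⟶[ T ] v) _ (_ , wT , _) (inj₁ (T' , r , refl)) ρ =
    +-monoˡ-< (wTm v ρ) (+-monoʳ-< (wTm u ρ) (decrease-ty T T' wT r ρ))
  decrease-ty (u ⟶[ T ] v) _ (wu , _ , _) (inj₂ (inj₁ (_ , u' , r , refl))) ρ =
    +-monoˡ-< (wTm v ρ) (+-monoˡ-< (wTy T ρ) (decrease-tm u u' wu r ρ))
  decrease-ty (u ⟶[ T ] v) _ (_ , _ , wv) (inj₂ (inj₂ (_ , _ , v' , r , refl))) ρ =
    +-monoʳ-< (wTm u ρ + wTy T ρ) (decrease-tm v v' wv r ρ)

no-infinite-chain : {X : Set} (Inv : X → Set) (_↝_ : X → X → Set) (μ : X → ℕ) →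
  (∀ x y → Inv x → x ↝ y → Inv y) → (∀ x y → Inv x → x ↝ y → μ y < μ x) →
  ∀ x → Inv x → ¬ (Σ (ℕ → X) λ f → f zero ≡ x × ((n : ℕ) → f n ↝ f (suc n)))
no-infinite-chain {X} Inv _↝_ μ preserve decrease x inv₀ (f , refl , step) = go 0 inv₀ (<-wellFounded (μ (f 0)))
  where
    go : ∀ n → Inv (f n) → Acc _<_ (μ (f n)) → ⊥
    go n inv (acc rs) = go (suc n) (preserve _ _ inv (step n)) (rs (decrease _ _ inv (step n)))

mainTheorem2 :
    ((Γ : Ctx) (A : Ty) → ValidTy Γ A →
       ¬ (Σ (ℕ → Ty) λ f → f zero ≡ A × ((n : ℕ) → f n ⇝ty f (suc n))))
    × ((Γ : Ctx) (t : Tm) → ValidTm Γ t →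
       ¬ (Σ (ℕ → Tm) λ f → f zero ≡ t × ((n : ℕ) → f n ⇝tm f (suc n))))
    × ((Γ : Ctx) (σ : Sub) → ValidSub Γ σ →
       ¬ (Σ (ℕ → Sub) λ f → f zero ≡ σ × ((n : ℕ) → f n ⇝s f (suc n))))
mainTheorem2 =
    (λ Γ A valid → no-infinite-chain WsTy _⇝ty_ (λ A → wTy A ones)
       ws-reduct-ty (λ A A' w r → decrease-ty A A' w r ones) A (proj₁ (ws-ty valid)))
  , (λ Γ t (_ , valid) → no-infinite-chain WsTm _⇝tm_ (λ t → wTm t ones)
       ws-reduct-tm (λ t t' w r → decrease-tm t t' w r ones) t (proj₁ (ws-tm valid)))
  , (λ Γ σ (_ , valid) → no-infinite-chain WsSub _⇝s_ (λ σ → wSub σ ones)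
       ws-reduct-sub (λ σ σ' w r → decrease-sub σ σ' w r ones) σ (proj₁ (ws-sub valid)))
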